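{- Let $a,b\in\mathbb{Z}[i]\setminus\{0\}$ have Gauss remainder $r\neq0$. If $\Im(u_b b)\,\Im(u_r r)<0$, $\phi_{\mathbb{Z}[i]}(r)\geq\phi_{\mathbb{Z}[i]}(b)=n$, and $m(b)\geq\ell_\infty(r)$, then $\phi_{\mathbb{Z}[i]}\left(r-\frac{u_b i}{s(r)u_r}b\right)<\phi_{\mathbb{Z}[i]}(b)$.
   Context: $\mathbb{Z}[i]$ has units $\pm1,\pm i$ and norm $\mathrm{Nm}(x+yi)=x^2+y^2$. A function $f:\mathbb{Z}[i]\setminus\{0\}\to W$ ($W$ a well-ordered set having $\mathbb{N}$ as an initial segment) is Euclidean if for all nonzero $a,b$ there exist $q,r$ with $a=qb+r$ and either $r=0$ or $f(r)<f(b)$. $\phi_{\mathbb{Z}[i]}$ is the minimal Euclidean function, the pointwise minimum of all Euclidean functions (equivalently, the minimal $n$ such that $z=\sum_{j=0}^n u_j(1+i)^j$ with $u_j\in\{0,\pm1,\pm i\}$, $u_n\ne0$). Gauss remainder: write $a\bar b/\mathrm{Nm}(b)=\alpha+\beta i$; let $\lfloor x\rceil=\lfloor x\rfloor$ if $0\le x-\lfloor x\rfloor\le1/2$ and $\lceil x\rceil$ otherwise; $q=\lfloor\alpha\rceil+\lfloor\beta\rceil i$ and $r=a-qb$. $\ell_\infty(x+yi)=\max(|x|,|y|)$, $m(x+yi)=\min(|x|,|y|)$. For $z\ne0$, $u_z$ is the unique unit with $\Re(u_z z)=\ell_\infty(z)$ if $\ell_\infty(z)\ne m(z)$, and the unique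 unit with $u_z z=\ell_\infty(z)(1+i)$ if $\ell_\infty(z)=m(z)$. $s(r)=\mathrm{sgn}(\Im(u_r r))$ (nonzero under the hypotheses). -}

module Defs where

open import Data.Nat as ℕ using (ℕ; zero; suc; _≤ᵇ_)
open import Data.Integer as ℤ using (ℤ; +_; -[1+_]; +[1+_]; ∣_∣; _/ℕ_; _%ℕ_)
open import Data.Bool using (if_then_else_)
open import Data.Maybe using (Maybe; just; nothing)
open import Data.Vec using (Vec; []; _∷_)
open import Data.Product using (Σ; _×_)
open import Relation.Binary.PropositionalEquality using (_≡_; _≢_)

record ℤ[i] : Set where
  constructor _+_i
  field
    re : ℤ
    im : ℤ
open ℤ[i] public

infixl 6 _+ᵍ_ _-ᵍ_
infixl 7 _*ᵍ_

_+ᵍ_ : ℤ[i] → ℤ[i] → ℤ[i]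
(a + b i) +ᵍ (c + d i) = (a ℤ.+ c) + (b ℤ.+ d) i

_-ᵍ_ : ℤ[i] → ℤ[i] → ℤ[i]
(a + b i) -ᵍ (c + d i) = (a ℤ.- c) + (b ℤ.- d) i

_*ᵍ_ : ℤ[i] → ℤ[i] → ℤ[i]
(a + b i) *ᵍ (c + d i) = (a ℤ.* c ℤ.- b ℤ.* d) + (a ℤ.* d ℤ.+ b ℤ.* c) i

conj : ℤ[i] → ℤ[i]
conj (a + b i) = a + (ℤ.- b) i

0ᵍ 1ᵍ iᵍ 1+iᵍ : ℤ[i]
0ᵍ = (+ 0) + (+ 0) i
1ᵍ = (+ 1) + (+ 0) i
iᵍ = (+ 0) + (+ 1) i
1+iᵍ = (+ 1) + (+ 1) i

ℤ→ᵍ : ℤ → ℤ[i]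
ℤ→ᵍ n = n + (+ 0) i

Nm : ℤ[i] → ℕ
Nm (x + y i) = ∣ x ∣ ℕ.* ∣ x ∣ ℕ.+ ∣ y ∣ ℕ.* ∣ y ∣

ℓ∞ : ℤ[i] → ℕ
ℓ∞ (x + y i) = ∣ x ∣ ℕ.⊔ ∣ y ∣

mᵍ : ℤ[i] → ℕ
mᵍ (x + y i) = ∣ x ∣ ℕ.⊓ ∣ y ∣

data Unit : Set where
  u1 u-1 ui u-i : Unit

unit : Unit → ℤ[i]
unit u1  = 1ᵍ
unit u-1 = (ℤ.- (+ 1)) + (+ 0) i
unit ui  = iᵍ
unit u-i = (+ 0) + (ℤ.- (+ 1)) i

IsUz : ℤ[i] → Unit → Set
IsUz z u =
  (ℓ∞ z ≢ mᵍ z → re (unit u *ᵍ z) ≡ + ℓ∞ z) ×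
  (ℓ∞ z ≡ mᵍ z → unit u *ᵍ z ≡ (+ ℓ∞ z) + (+ ℓ∞ z) i)

sgn : ℤ → ℤ
sgn (+ zero)    = + 0
sgn +[1+ _ ]    = + 1
sgn -[1+ _ ]    = ℤ.- (+ 1)

s : ℤ[i] → Unit → ℤ
s r ur = sgn (im (unit ur *ᵍ r))

-- ⌊ X / N ⌉ : floor if the fractional part is ≤ 1/2, ceiling otherwise
-- (N = 0 never occurs for b ≠ 0; it is given the junk value 0)
roundDiv : ℤ → ℕ → ℤ
roundDiv X zero = + 0
roundDiv X N@(suc _) =
  if (2 ℕ.* (X %ℕ N)) ≤ᵇ N then X /ℕ N else (X /ℕ N) ℤ.+ (+ 1)

-- q = ⌊α⌉ + ⌊β⌉ i where a b̄ / Nm(b) = α + β i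
gaussQuot : ℤ[i] → ℤ[i] → ℤ[i]
gaussQuot a b =
  let p = a *ᵍ conj b in
  roundDiv (re p) (Nm b) + roundDiv (im p) (Nm b) i

gaussRem : ℤ[i] → ℤ[i] → ℤ[i]
gaussRem a b = a -ᵍ gaussQuot a b *ᵍ b

-- φ_{ℤ[i]} via (1+i)-adic expansions with digits in {0, ±1, ±i}

digit : Maybe Unit → ℤ[i]
digit nothing  = 0ᵍ
digit (just u) = unit u

-- value of  Σ_{j<k} d_j (1+i)^j + u (1+i)^k
evalExp : ∀ {k} → Vec (Maybe Unit) k → Unit → ℤ[i]
evalExp []       u = unit u
evalExp (d ∷ ds) u = digit d +ᵍ 1+iᵍ *ᵍ evalExp ds u

Rep : ℕ → ℤ[i] → Set
Rep k z = Σ (Vec (Maybe Unit) k) λ ds → Σ Unit λ u → evalExp ds u ≡ z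

IsPhi : ℤ[i] → ℕ → Set
IsPhi z n = Rep n z × (∀ k → Rep k z → n ℕ.≤ k)

{-# OPTIONS --safe #-}
module Submission where

-- Multiplying b and r by u_b and u_r, and conjugating one of them, brings them to
-- Lb + mb i and Lr + mr i with mr ≤ Lr ≤ mb ≤ Lb; the new remainder becomes, up to
-- a unit and conjugation, W = (mb − Lr) + (Lb − mr) i. The sets {φ ≤ n} are
-- governed by octagons: {φ ≤ n} lies in the octagon |x|, |y| ≤ w n,
-- |x| + |y| < w (n + 1); every point of that octagon not divisible by 2 lies in
-- {φ ≤ n}; and so do a diamond and a strip along the real axis. Since φ(b) = n + 1
-- and φ(r) > n, b lies inside and r outside suitable regions, and linear estimates
-- place W in {φ ≤ n}. When b, r and W are all divisible by 2, halving all three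
-- lowers φ by 2 and the argument recurses.

open import Defs

-- Anonymous, so that the integer order opened here does not clash with the order
-- on ℕ used in the statement of lemma8.
module _ where

  open import Data.Bool using (Bool; true; false; _∨_)
  open import Data.Empty using (⊥; ⊥-elim)
  open import Data.Integer using (ℤ; +_; -[1+_]; ∣_∣; _+_; _-_; _*_; -_; _≤_; _<_; +≤+; +<+)
  import Data.Integer.Properties as ℤP
  open import Data.Integer.Tactic.RingSolver using (solve; solve-∀)
  open import Data.List using (_∷_; [])
  open import Data.Maybe using (Maybe; just; nothing)
  open import Data.Nat as ℕ using (ℕ; zero; suc; z≤n; s≤s)
  import Data.Nat.Properties as ℕP
  open import Data.Product using (Σ; ∃-syntax; _×_; _,_)
  open import Data.Sum using (_⊎_; inj₁; inj₂)
  open import Data.Vec as Vec using (Vec)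
  open import Relation.Binary.PropositionalEquality
  open ≡-Reasoning
  open import Relation.Nullary using (Dec; yes; no; ¬_)
  open import Relation.Nullary.Decidable using (True; toWitness)

  -- To prove x ≤ y we write y − x as a sum of slacks of hypotheses and of
  -- nonnegative constants; the ring solver checks the identity.

  slack : ∀ {a b} → a ≤ b → + 0 ≤ b - a
  slack {a} {b} a≤b = subst (_≤ b - a) (ℤP.+-inverseʳ a) (ℤP.+-monoˡ-≤ (- a) a≤b)

  infixl 5 _⊕_

  _⊕_ : ∀ {a b} → + 0 ≤ a → + 0 ≤ b → + 0 ≤ a + b
  _⊕_ = ℤP.+-mono-≤

  nonneg : ∀ n → + 0 ≤ + n
  nonneg n = +≤+ z≤n

  ≤-by-slack : ∀ {x y} s → + 0 ≤ s → y - x ≡ s → x ≤ y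
  ≤-by-slack {x} {y} s 0≤s y-x≡s =
    subst₂ _≤_ (ℤP.+-identityˡ x) (y-x+x≡y x y) (ℤP.+-monoˡ-≤ x (subst (+ 0 ≤_) (sym y-x≡s) 0≤s))
    where
    y-x+x≡y : ∀ x y → y - x + x ≡ y
    y-x+x≡y = solve-∀

  ≤+nonneg : ∀ a {p} → + 0 ≤ p → a ≤ a + p
  ≤+nonneg a {p} 0≤p = ≤-by-slack _ 0≤p (solve (a ∷ p ∷ []))

  ≤+nonnegˡ : ∀ a {p} → + 0 ≤ p → a ≤ p + a
  ≤+nonnegˡ a {p} 0≤p = ≤-by-slack _ 0≤p (solve (a ∷ p ∷ []))

  +1-mono-+2 : ∀ {a b} → a + + 2 ≤ b → a + + 1 + + 1 ≤ b
  +1-mono-+2 {a} {b} h = ≤-by-slack _ (slack h) (solve (a ∷ b ∷ []))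

  ≤-by-decide : ∀ {x y} {t : True (x ℤP.≤? y)} → x ≤ y
  ≤-by-decide {t = t} = toWitness t

  ≰⇒+1≤ : ∀ {a b} → ¬ (a ≤ b) → b + + 1 ≤ a
  ≰⇒+1≤ {a} {b} a≰b = subst (_≤ a) (ℤP.+-comm (+ 1) b) (ℤP.i<j⇒suc[i]≤j (ℤP.≰⇒> a≰b))

  +1≤+1⇒≤ : ∀ {a b} → a + + 1 ≤ b + + 1 → a ≤ b
  +1≤+1⇒≤ {a} {b} h = ≤-by-slack _ (slack h) (solve (a ∷ b ∷ []))

  ≤+1⇒-1≤ : ∀ {a b} → a ≤ b + + 1 → a - + 1 ≤ b
  ≤+1⇒-1≤ {a} {b} h = ≤-by-slack _ (slack h) (solve (a ∷ b ∷ []))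

  +1≤⇒≤-1 : ∀ {a b} → a + + 1 ≤ b → a ≤ b - + 1
  +1≤⇒≤-1 {a} {b} h = ≤-by-slack _ (slack h) (solve (a ∷ b ∷ []))

  ≤-from-¬ : ∀ {A : Set} a b → ¬ A → (a + + 1 ≤ b → A) → b ≤ a
  ≤-from-¬ a b ¬A a<b⇒A with a + + 1 ℤP.≤? b
  ... | yes a<b = ⊥-elim (¬A (a<b⇒A a<b))
  ... | no a≮b = +1≤+1⇒≤ {b} {a} (≰⇒+1≤ a≮b)

  1≰0 : ¬ (+ 1 ≤ + 0)
  1≰0 (+≤+ ())

  half-≤ : ∀ p r → p + p ≤ r + r + + 1 → p ≤ r
  half-≤ p r h with p ℤP.≤? r
  ... | yes p≤r = p≤r
  ... | no p≰r = ⊥-elim (1≰0 (≤-by-slack _ (slack h ⊕ slack r+1≤p ⊕ slack r+1≤p) (solve (p ∷ r ∷ []))))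
    where
    r+1≤p : r + + 1 ≤ p
    r+1≤p = ≰⇒+1≤ p≰r

  double-cancel-≤ : ∀ p r → p + p ≤ r + r → p ≤ r
  double-cancel-≤ p r h = half-≤ p r (≤-by-slack _ (slack h ⊕ nonneg 1) (solve (p ∷ r ∷ [])))

  double-nonneg⁻¹ : ∀ s → + 0 ≤ s + s → + 0 ≤ s
  double-nonneg⁻¹ s = double-cancel-≤ (+ 0) s

  double-pos⁻¹ : ∀ s → + 1 ≤ s + s → + 1 ≤ s
  double-pos⁻¹ s 1≤2s with s ℤP.≤? + 0
  ... | yes s≤0 = ⊥-elim (1≰0 (ℤP.≤-trans 1≤2s (ℤP.+-mono-≤ s≤0 s≤0)))
  ... | no s≰0 = ≰⇒+1≤ s≰0

  double-injective : ∀ {p r} → p + p ≡ r + r → p ≡ r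
  double-injective {p} {r} eq =
    ℤP.≤-antisym (double-cancel-≤ p r (ℤP.≤-reflexive eq)) (double-cancel-≤ r p (ℤP.≤-reflexive (sym eq)))

  +suc : ∀ n → + suc n ≡ + n + + 1
  +suc n = cong +_ (ℕP.+-comm 1 n)

  Even Odd : ℤ → Set
  Even x = ∃[ k ] x ≡ k + k
  Odd x = ∃[ k ] x ≡ k + k + + 1

  ¬Even∧Odd : ∀ {x} → Even x → Odd x → ⊥
  ¬Even∧Odd (k , refl) (j , 2k≡2j+1) =
    1≰0 (≤-by-slack _ (slack k≤j ⊕ slack j+1≤k) (solve (k ∷ j ∷ [])))
    where
    regroup : ∀ j → (j + + 1) + (j + + 1) ≡ j + j + + 1 + + 1
    regroup = solve-∀
    k≤j : k ≤ j
    k≤j = half-≤ k j (ℤP.≤-reflexive 2k≡2j+1)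
    j+1≤k : j + + 1 ≤ k
    j+1≤k = half-≤ (j + + 1) k (ℤP.≤-reflexive (trans (regroup j) (cong (_+ + 1) (sym 2k≡2j+1))))

  Even-neg : ∀ {x} → Even x → Even (- x)
  Even-neg (k , refl) = - k , solve (k ∷ [])

  Odd-neg : ∀ {x} → Odd x → Odd (- x)
  Odd-neg (k , refl) = - k - + 1 , solve (k ∷ [])

  even-or-odd-ℕ : ∀ n → Even (+ n) ⊎ Odd (+ n)
  even-or-odd-ℕ zero = inj₁ (+ 0 , refl)
  even-or-odd-ℕ (suc n) with even-or-odd-ℕ n
  ... | inj₁ (k , n≡2k) = inj₂ (k , trans (+suc n) (cong (_+ + 1) n≡2k))
  ... | inj₂ (k , n≡2k+1) = inj₁ (k + + 1 , trans (+suc n) (trans (cong (_+ + 1) n≡2k+1) (solve (k ∷ []))))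

  even-or-odd : ∀ x → Even x ⊎ Odd x
  even-or-odd (+ n) = even-or-odd-ℕ n
  even-or-odd -[1+ n ] with even-or-odd-ℕ (suc n)
  ... | inj₁ e = inj₁ (Even-neg e)
  ... | inj₂ o = inj₂ (Odd-neg o)

  Odd+Even : ∀ {x y} → Odd x → Even y → Odd (x + y)
  Odd+Even (a , refl) (b , refl) = a + b , solve (a ∷ b ∷ [])

  +-cancelˡ-≡ : ∀ x y {s} → x + y ≡ s → y ≡ s - x
  +-cancelˡ-≡ x y {s} x+y≡s = begin
    y          ≡⟨ solve (x ∷ y ∷ []) ⟩
    x + y - x  ≡⟨ cong (_- x) x+y≡s ⟩
    s - x      ∎

  +-cancelʳ-≡ : ∀ x y {s} → x + y ≡ s → x ≡ s - y
  +-cancelʳ-≡ x y {s} x+y≡s = begin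
    x          ≡⟨ solve (x ∷ y ∷ []) ⟩
    x + y - y  ≡⟨ cong (_- y) x+y≡s ⟩
    s - y      ∎

  Odd-cancelˡ : ∀ {x y} → Odd (x + y) → Odd x → Even y
  Odd-cancelˡ {y = y} (c , x+y≡2c+1) (a , refl) = c - a , trans (+-cancelˡ-≡ (a + a + + 1) y x+y≡2c+1) (solve (a ∷ c ∷ []))

  Even-cancelˡ : ∀ {x y} → Odd (x + y) → Even x → Odd y
  Even-cancelˡ {y = y} (c , x+y≡2c+1) (a , refl) = c - a , trans (+-cancelˡ-≡ (a + a) y x+y≡2c+1) (solve (a ∷ c ∷ []))

  Odd≤Even⇒< : ∀ {x h} → Odd x → x ≤ h + h → x + + 1 ≤ h + h
  Odd≤Even⇒< {x} {h} odd x≤2h = subst (_≤ h + h) (ℤP.+-comm (+ 1) x)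
    (ℤP.i<j⇒suc[i]≤j (ℤP.≤∧≢⇒< x≤2h λ x≡2h → ¬Even∧Odd (h , x≡2h) odd))

  -- w n = 3·2^(n/2) − 2 for even n and 2^((n+3)/2) − 2 for odd n.
  w : ℕ → ℤ
  w zero = + 1
  w (suc zero) = + 2
  w (suc (suc n)) = w n + w n + + 2

  2^⌈_/2⌉ : ℕ → ℤ
  2^⌈ zero /2⌉ = + 1
  2^⌈ suc zero /2⌉ = + 2
  2^⌈ suc (suc n) /2⌉ = 2^⌈ n /2⌉ + 2^⌈ n /2⌉

  2^⌊_/2⌋ : ℕ → ℤ
  2^⌊ zero /2⌋ = + 1
  2^⌊ suc zero /2⌋ = + 1
  2^⌊ suc (suc n) /2⌋ = 2^⌊ n /2⌋ + 2^⌊ n /2⌋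

  w-suc : ∀ n → w (suc n) ≡ w n + 2^⌈ n /2⌉
  w-suc zero = refl
  w-suc (suc zero) = refl
  w-suc (suc (suc n)) = trans (cong (λ t → t + t + + 2) (w-suc n)) (regroup (w n) (2^⌈ n /2⌉))
    where
    regroup : ∀ a p → (a + p) + (a + p) + + 2 ≡ (a + a + + 2) + (p + p)
    regroup = solve-∀

  2^⌈suc/2⌉ : ∀ n → 2^⌈ suc n /2⌉ ≡ 2^⌊ n /2⌋ + 2^⌊ n /2⌋
  2^⌈suc/2⌉ zero = refl
  2^⌈suc/2⌉ (suc zero) = refl
  2^⌈suc/2⌉ (suc (suc n)) = cong (λ t → t + t) (2^⌈suc/2⌉ n)

  w-suc-suc : ∀ n → w (suc (suc n)) ≡ w (suc n) + (2^⌊ n /2⌋ + 2^⌊ n /2⌋)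
  w-suc-suc n = trans (w-suc (suc n)) (cong (_+_ (w (suc n))) (2^⌈suc/2⌉ n))

  double-pos : ∀ {p} → + 1 ≤ p → + 2 ≤ p + p
  double-pos {p} 1≤p = ≤-by-slack _ (slack 1≤p ⊕ slack 1≤p) (solve (p ∷ []))

  2^⌊/2⌋-pos : ∀ n → + 1 ≤ 2^⌊ n /2⌋
  2^⌊/2⌋-pos zero = ≤-by-decide
  2^⌊/2⌋-pos (suc zero) = ≤-by-decide
  2^⌊/2⌋-pos (suc (suc n)) = ℤP.≤-trans ≤-by-decide (double-pos (2^⌊/2⌋-pos n))

  2^⌈/2⌉-pos : ∀ n → + 1 ≤ 2^⌈ n /2⌉
  2^⌈/2⌉-pos zero = ≤-by-decide
  2^⌈/2⌉-pos (suc zero) = ≤-by-decide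
  2^⌈/2⌉-pos (suc (suc n)) = ℤP.≤-trans ≤-by-decide (double-pos (2^⌈/2⌉-pos n))

  2≤2^⌈suc/2⌉ : ∀ n → + 2 ≤ 2^⌈ suc n /2⌉
  2≤2^⌈suc/2⌉ n = subst (+ 2 ≤_) (sym (2^⌈suc/2⌉ n)) (double-pos (2^⌊/2⌋-pos n))

  w-suc-even : ∀ n → Even (w (suc n))
  w-suc-even zero = + 1 , refl
  w-suc-even (suc n) = w n + + 1 , regroup (w n)
    where
    regroup : ∀ a → a + a + + 2 ≡ (a + + 1) + (a + + 1)
    regroup = solve-∀

  2^⌈/2⌉≤w : ∀ n → 2^⌈ n /2⌉ ≤ w n
  2^⌈/2⌉≤w zero = ≤-by-decide
  2^⌈/2⌉≤w (suc zero) = ≤-by-decide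
  2^⌈/2⌉≤w (suc (suc n)) = ℤP.≤-trans (ℤP.+-mono-≤ p≤a p≤a) (ℤP.i≤i+j _ (+ 2))
    where p≤a = 2^⌈/2⌉≤w n

  2^⌈suc/2⌉≤w+1 : ∀ n → 2^⌈ suc n /2⌉ ≤ w n + + 1
  2^⌈suc/2⌉≤w+1 zero = ≤-by-decide
  2^⌈suc/2⌉≤w+1 (suc zero) = ≤-by-decide
  2^⌈suc/2⌉≤w+1 (suc (suc n)) = double-≤-+1 (2^⌈ suc n /2⌉) (w n) (2^⌈suc/2⌉≤w+1 n)
    where
    double-≤-+1 : ∀ p a → p ≤ a + + 1 → p + p ≤ a + a + + 2 + + 1
    double-≤-+1 p a h = ≤-by-slack _ (slack h ⊕ slack h ⊕ nonneg 1) (solve (p ∷ a ∷ []))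

  2^⌊/2⌋-double-1≤w : ∀ n → 2^⌊ n /2⌋ + 2^⌊ n /2⌋ - + 1 ≤ w n
  2^⌊/2⌋-double-1≤w n = ≤+1⇒-1≤ (subst (_≤ w n + + 1) (2^⌈suc/2⌉ n) (2^⌈suc/2⌉≤w+1 n))

  2^⌊/2⌋-double-1≤w-suc-1 : ∀ n → 2^⌊ n /2⌋ + 2^⌊ n /2⌋ - + 1 ≤ w (suc n) - + 1
  2^⌊/2⌋-double-1≤w-suc-1 n = ℤP.+-monoˡ-≤ (- + 1) (subst (_≤ w (suc n)) (2^⌈suc/2⌉ n) (2^⌈/2⌉≤w (suc n)))

  w-suc≤2w : ∀ n → w (suc n) ≤ w n + w n
  w-suc≤2w n = subst (_≤ w n + w n) (sym (w-suc n)) (ℤP.+-monoʳ-≤ (w n) (2^⌈/2⌉≤w n))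

  w-mono-suc : ∀ n → w n ≤ w (suc n)
  w-mono-suc n = subst (w n ≤_) (sym (w-suc n)) (≤+nonneg (w n) (ℤP.≤-trans ≤-by-decide (2^⌈/2⌉-pos n)))

  2≤w-suc : ∀ n → + 2 ≤ w (suc n)
  2≤w-suc zero = ≤-by-decide
  2≤w-suc (suc n) = ℤP.≤-trans (2≤w-suc n) (w-mono-suc (suc n))

  w-mono : ∀ {k n} → k ℕ.≤ n → w k ≤ w n
  w-mono {n = zero} z≤n = ℤP.≤-refl
  w-mono {k} {suc n} k≤1+n with ℕP.m≤n⇒m<n∨m≡n k≤1+n
  ... | inj₂ refl = ℤP.≤-refl
  ... | inj₁ (s≤s k≤n) = ℤP.≤-trans (w-mono k≤n) (w-mono-suc n)

  w+2≤w-suc : ∀ n → w (suc n) + + 2 ≤ w (suc (suc n))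
  w+2≤w-suc n = subst (w (suc n) + + 2 ≤_) (sym (w-suc (suc n))) (ℤP.+-monoʳ-≤ (w (suc n)) (2≤2^⌈suc/2⌉ n))

  *ᵍ-assoc : ∀ p q r → (p *ᵍ q) *ᵍ r ≡ p *ᵍ (q *ᵍ r)
  *ᵍ-assoc (a + b i) (c + d i) (e + f i) = cong₂ _+_i (re-law a b c d e f) (im-law a b c d e f)
    where
    re-law : ∀ a b c d e f → (a * c - b * d) * e - (a * d + b * c) * f ≡ a * (c * e - d * f) - b * (c * f + d * e)
    re-law = solve-∀
    im-law : ∀ a b c d e f → (a * c - b * d) * f + (a * d + b * c) * e ≡ a * (c * f + d * e) + b * (c * e - d * f)
    im-law = solve-∀

  *ᵍ-comm : ∀ p q → p *ᵍ q ≡ q *ᵍ p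
  *ᵍ-comm (a + b i) (c + d i) = cong₂ _+_i (solve (a ∷ b ∷ c ∷ d ∷ [])) (solve (a ∷ b ∷ c ∷ d ∷ []))

  *ᵍ-identityˡ : ∀ z → 1ᵍ *ᵍ z ≡ z
  *ᵍ-identityˡ (a + b i) = cong₂ _+_i (solve (a ∷ b ∷ [])) (solve (a ∷ b ∷ []))

  +ᵍ-identityˡ : ∀ z → 0ᵍ +ᵍ z ≡ z
  +ᵍ-identityˡ (a + b i) = cong₂ _+_i (ℤP.+-identityˡ a) (ℤP.+-identityˡ b)

  *ᵍ-distribˡ-+ᵍ : ∀ p q r → p *ᵍ (q +ᵍ r) ≡ p *ᵍ q +ᵍ p *ᵍ r
  *ᵍ-distribˡ-+ᵍ (a + b i) (c + d i) (e + f i) = cong₂ _+_i (re-law a b c d e f) (im-law a b c d e f)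
    where
    re-law : ∀ a b c d e f → a * (c + e) - b * (d + f) ≡ (a * c - b * d) + (a * e - b * f)
    re-law = solve-∀
    im-law : ∀ a b c d e f → a * (d + f) + b * (c + e) ≡ (a * d + b * c) + (a * f + b * e)
    im-law = solve-∀

  *ᵍ-distribˡ-minusᵍ : ∀ p q r → p *ᵍ (q -ᵍ r) ≡ p *ᵍ q -ᵍ p *ᵍ r
  *ᵍ-distribˡ-minusᵍ (a + b i) (c + d i) (e + f i) = cong₂ _+_i (re-law a b c d e f) (im-law a b c d e f)
    where
    re-law : ∀ a b c d e f → a * (c - e) - b * (d - f) ≡ (a * c - b * d) - (a * e - b * f)
    re-law = solve-∀
    im-law : ∀ a b c d e f → a * (d - f) + b * (c - e) ≡ (a * d + b * c) - (a * f + b * e)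
    im-law = solve-∀

  *ᵍ-left-comm : ∀ p q r → p *ᵍ (q *ᵍ r) ≡ q *ᵍ (p *ᵍ r)
  *ᵍ-left-comm p q r = begin
    p *ᵍ (q *ᵍ r)  ≡⟨ sym (*ᵍ-assoc p q r) ⟩
    (p *ᵍ q) *ᵍ r  ≡⟨ cong (_*ᵍ r) (*ᵍ-comm p q) ⟩
    (q *ᵍ p) *ᵍ r  ≡⟨ *ᵍ-assoc q p r ⟩
    q *ᵍ (p *ᵍ r)  ∎

  conj-+ᵍ : ∀ p q → conj (p +ᵍ q) ≡ conj p +ᵍ conj q
  conj-+ᵍ (a + b i) (c + d i) = cong ((a + c) +_i) (ℤP.neg-distrib-+ b d)

  conj-*ᵍ : ∀ p q → conj (p *ᵍ q) ≡ conj p *ᵍ conj q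
  conj-*ᵍ (a + b i) (c + d i) = cong₂ _+_i (re-law a b c d) (im-law a b c d)
    where
    re-law : ∀ a b c d → a * c - b * d ≡ a * c - (- b) * (- d)
    re-law = solve-∀
    im-law : ∀ a b c d → - (a * d + b * c) ≡ a * (- d) + (- b) * c
    im-law = solve-∀

  infixl 7 _·ᵘ_

  _·ᵘ_ : Unit → Unit → Unit
  u1 ·ᵘ u = u
  u-1 ·ᵘ u1 = u-1
  u-1 ·ᵘ u-1 = u1
  u-1 ·ᵘ ui = u-i
  u-1 ·ᵘ u-i = ui
  ui ·ᵘ u1 = ui
  ui ·ᵘ u-1 = u-i
  ui ·ᵘ ui = u-1
  ui ·ᵘ u-i = u1
  u-i ·ᵘ u1 = u-i
  u-i ·ᵘ u-1 = ui
  u-i ·ᵘ ui = u1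
  u-i ·ᵘ u-i = u-1

  unit-·ᵘ : ∀ c u → unit (c ·ᵘ u) ≡ unit c *ᵍ unit u
  unit-·ᵘ u1 u1 = refl
  unit-·ᵘ u1 u-1 = refl
  unit-·ᵘ u1 ui = refl
  unit-·ᵘ u1 u-i = refl
  unit-·ᵘ u-1 u1 = refl
  unit-·ᵘ u-1 u-1 = refl
  unit-·ᵘ u-1 ui = refl
  unit-·ᵘ u-1 u-i = refl
  unit-·ᵘ ui u1 = refl
  unit-·ᵘ ui u-1 = refl
  unit-·ᵘ ui ui = refl
  unit-·ᵘ ui u-i = refl
  unit-·ᵘ u-i u1 = refl
  unit-·ᵘ u-i u-1 = refl
  unit-·ᵘ u-i ui = refl
  unit-·ᵘ u-i u-i = refl

  conjᵘ : Unit → Unit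
  conjᵘ u1 = u1
  conjᵘ u-1 = u-1
  conjᵘ ui = u-i
  conjᵘ u-i = ui

  unit-conjᵘ : ∀ u → unit (conjᵘ u) ≡ conj (unit u)
  unit-conjᵘ u1 = refl
  unit-conjᵘ u-1 = refl
  unit-conjᵘ ui = refl
  unit-conjᵘ u-i = refl

  conjᵘ-inverseˡ : ∀ u → unit (conjᵘ u) *ᵍ unit u ≡ 1ᵍ
  conjᵘ-inverseˡ u1 = refl
  conjᵘ-inverseˡ u-1 = refl
  conjᵘ-inverseˡ ui = refl
  conjᵘ-inverseˡ u-i = refl

  conjᵘ-cancel : ∀ u z → unit (conjᵘ u) *ᵍ (unit u *ᵍ z) ≡ z
  conjᵘ-cancel u z = begin
    unit (conjᵘ u) *ᵍ (unit u *ᵍ z)  ≡⟨ sym (*ᵍ-assoc (unit (conjᵘ u)) (unit u) z) ⟩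
    (unit (conjᵘ u) *ᵍ unit u) *ᵍ z  ≡⟨ cong (_*ᵍ z) (conjᵘ-inverseˡ u) ⟩
    1ᵍ *ᵍ z                          ≡⟨ *ᵍ-identityˡ z ⟩
    z                                ∎

  i*ᵍ : ∀ a b → unit ui *ᵍ (a + b i) ≡ (- b) + a i
  i*ᵍ a b = cong₂ _+_i (solve (a ∷ b ∷ [])) (solve (a ∷ b ∷ []))

  -i*ᵍ : ∀ a b → unit u-i *ᵍ (a + b i) ≡ b + (- a) i
  -i*ᵍ a b = cong₂ _+_i (solve (a ∷ b ∷ [])) (solve (a ∷ b ∷ []))

  -1*ᵍ : ∀ a b → unit u-1 *ᵍ (a + b i) ≡ (- a) + (- b) i
  -1*ᵍ a b = cong₂ _+_i (solve (a ∷ b ∷ [])) (solve (a ∷ b ∷ []))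

  1+i*ᵍ : ∀ a b → 1+iᵍ *ᵍ (a + b i) ≡ (a - b) + (b + a) i
  1+i*ᵍ a b = cong₂ _+_i (solve (a ∷ b ∷ [])) (solve (a ∷ b ∷ []))

  _·ᵈ_ : Unit → Maybe Unit → Maybe Unit
  c ·ᵈ nothing = nothing
  c ·ᵈ just u = just (c ·ᵘ u)

  digit-·ᵈ : ∀ c d → digit (c ·ᵈ d) ≡ unit c *ᵍ digit d
  digit-·ᵈ u1 nothing = refl
  digit-·ᵈ u-1 nothing = refl
  digit-·ᵈ ui nothing = refl
  digit-·ᵈ u-i nothing = refl
  digit-·ᵈ c (just u) = unit-·ᵘ c u

  conjᵈ : Maybe Unit → Maybe Unit
  conjᵈ nothing = nothing
  conjᵈ (just u) = just (conjᵘ u)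

  digit-conjᵈ : ∀ d → digit (conjᵈ d) ≡ conj (digit d)
  digit-conjᵈ nothing = refl
  digit-conjᵈ (just u) = unit-conjᵘ u

  *ᵍ-digit-step : ∀ c d e → c *ᵍ (d +ᵍ 1+iᵍ *ᵍ e) ≡ c *ᵍ d +ᵍ 1+iᵍ *ᵍ (c *ᵍ e)
  *ᵍ-digit-step c d e =
    trans (*ᵍ-distribˡ-+ᵍ c d (1+iᵍ *ᵍ e)) (cong (c *ᵍ d +ᵍ_) (*ᵍ-left-comm c 1+iᵍ e))

  -- conj (1+i) = (1+i)(−i)
  conj-digit-step : ∀ c d e → c *ᵍ conj (d +ᵍ 1+iᵍ *ᵍ e) ≡ c *ᵍ conj d +ᵍ 1+iᵍ *ᵍ ((c *ᵍ unit u-i) *ᵍ conj e)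
  conj-digit-step c d e = begin
    c *ᵍ conj (d +ᵍ 1+iᵍ *ᵍ e)
      ≡⟨ cong (c *ᵍ_) (trans (conj-+ᵍ d (1+iᵍ *ᵍ e)) (cong (conj d +ᵍ_) (conj-*ᵍ 1+iᵍ e))) ⟩
    c *ᵍ (conj d +ᵍ (1+iᵍ *ᵍ unit u-i) *ᵍ conj e)
      ≡⟨ *ᵍ-distribˡ-+ᵍ c (conj d) _ ⟩
    c *ᵍ conj d +ᵍ c *ᵍ ((1+iᵍ *ᵍ unit u-i) *ᵍ conj e)
      ≡⟨ cong (λ t → c *ᵍ conj d +ᵍ c *ᵍ t) (*ᵍ-assoc 1+iᵍ (unit u-i) (conj e)) ⟩
    c *ᵍ conj d +ᵍ c *ᵍ (1+iᵍ *ᵍ (unit u-i *ᵍ conj e))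
      ≡⟨ cong (c *ᵍ conj d +ᵍ_) (*ᵍ-left-comm c 1+iᵍ _) ⟩
    c *ᵍ conj d +ᵍ 1+iᵍ *ᵍ (c *ᵍ (unit u-i *ᵍ conj e))
      ≡⟨ cong (λ t → c *ᵍ conj d +ᵍ 1+iᵍ *ᵍ t) (sym (*ᵍ-assoc c (unit u-i) (conj e))) ⟩
    c *ᵍ conj d +ᵍ 1+iᵍ *ᵍ ((c *ᵍ unit u-i) *ᵍ conj e)
      ∎

  scaleDigits : ∀ {k} → Unit → Vec (Maybe Unit) k → Vec (Maybe Unit) k
  scaleDigits c Vec.[] = Vec.[]
  scaleDigits c (d Vec.∷ ds) = c ·ᵈ d Vec.∷ scaleDigits c ds

  evalExp-scale : ∀ {k} c (ds : Vec (Maybe Unit) k) u →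
    evalExp (scaleDigits c ds) (c ·ᵘ u) ≡ unit c *ᵍ evalExp ds u
  evalExp-scale c Vec.[] u = unit-·ᵘ c u
  evalExp-scale c (d Vec.∷ ds) u =
    trans (cong₂ (λ x y → x +ᵍ 1+iᵍ *ᵍ y) (digit-·ᵈ c d) (evalExp-scale c ds u))
          (sym (*ᵍ-digit-step (unit c) (digit d) (evalExp ds u)))

  -- Conjugating an expansion multiplies its j-th digit by (−i)^j; the unit c
  -- carries that factor along.
  conjDigits : ∀ {k} → Unit → Vec (Maybe Unit) k → Vec (Maybe Unit) k
  conjDigits c Vec.[] = Vec.[]
  conjDigits c (d Vec.∷ ds) = c ·ᵈ conjᵈ d Vec.∷ conjDigits (c ·ᵘ u-i) ds

  conjLeading : ∀ {k} → Unit → Vec (Maybe Unit) k → Unit → Unit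
  conjLeading c Vec.[] u = c ·ᵘ conjᵘ u
  conjLeading c (d Vec.∷ ds) u = conjLeading (c ·ᵘ u-i) ds u

  evalExp-conj : ∀ {k} c (ds : Vec (Maybe Unit) k) u →
    evalExp (conjDigits c ds) (conjLeading c ds u) ≡ unit c *ᵍ conj (evalExp ds u)
  evalExp-conj c Vec.[] u = trans (unit-·ᵘ c (conjᵘ u)) (cong (unit c *ᵍ_) (unit-conjᵘ u))
  evalExp-conj c (d Vec.∷ ds) u =
    trans (cong₂ (λ x y → x +ᵍ 1+iᵍ *ᵍ y)
             (trans (digit-·ᵈ c (conjᵈ d)) (cong (unit c *ᵍ_) (digit-conjᵈ d)))
             (trans (evalExp-conj (c ·ᵘ u-i) ds u) (cong (_*ᵍ conj (evalExp ds u)) (unit-·ᵘ c u-i))))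
          (sym (conj-digit-step (unit c) (digit d) (evalExp ds u)))

  Rep-unit : ∀ {k z} c → Rep k z → Rep k (unit c *ᵍ z)
  Rep-unit c (ds , u , refl) = scaleDigits c ds , c ·ᵘ u , evalExp-scale c ds u

  Rep-conj : ∀ {k z} → Rep k z → Rep k (conj z)
  Rep-conj (ds , u , refl) =
    conjDigits u1 ds , conjLeading u1 ds u , trans (evalExp-conj u1 ds u) (*ᵍ-identityˡ _)

  Rep-step : ∀ {k v} d → Rep k v → Rep (suc k) (digit d +ᵍ 1+iᵍ *ᵍ v)
  Rep-step d (ds , u , refl) = d Vec.∷ ds , u , refl

  Rep-shift : ∀ {k v} → Rep k v → Rep (suc k) (1+iᵍ *ᵍ v)
  Rep-shift r = subst (Rep _) (+ᵍ-identityˡ _) (Rep-step nothing r)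

  -- (1+i)²(−i) = 2
  Rep-double : ∀ {k a b} → Rep k (a + b i) → Rep (suc (suc k)) ((a + a) + (b + b) i)
  Rep-double {a = a} {b} r = subst (Rep _) double (Rep-shift (Rep-shift (Rep-unit u-i r)))
    where
    double : 1+iᵍ *ᵍ (1+iᵍ *ᵍ (unit u-i *ᵍ (a + b i))) ≡ (a + a) + (b + b) i
    double = begin
      1+iᵍ *ᵍ (1+iᵍ *ᵍ (unit u-i *ᵍ (a + b i)))  ≡⟨ cong (λ t → 1+iᵍ *ᵍ (1+iᵍ *ᵍ t)) (-i*ᵍ a b) ⟩
      1+iᵍ *ᵍ (1+iᵍ *ᵍ (b + (- a) i))            ≡⟨ cong (1+iᵍ *ᵍ_) (1+i*ᵍ b (- a)) ⟩
      1+iᵍ *ᵍ ((b - - a) + (- a + b) i)          ≡⟨ 1+i*ᵍ (b - - a) (- a + b) ⟩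
      ((b - - a) - (- a + b)) + ((- a + b) + (b - - a)) i
        ≡⟨ cong₂ _+_i (solve (a ∷ b ∷ [])) (solve (a ∷ b ∷ [])) ⟩
      (a + a) + (b + b) i                        ∎

  φ≤ : ℕ → ℤ[i] → Set
  φ≤ n z = ∃[ k ] k ℕ.≤ n × Rep k z

  φ≤-unit : ∀ {n z} c → φ≤ n z → φ≤ n (unit c *ᵍ z)
  φ≤-unit c (k , k≤n , r) = k , k≤n , Rep-unit c r

  φ≤-unit⁻¹ : ∀ {n z} c → φ≤ n (unit c *ᵍ z) → φ≤ n z
  φ≤-unit⁻¹ {z = z} c h = subst (φ≤ _) (conjᵘ-cancel c z) (φ≤-unit (conjᵘ c) h)

  φ≤-conj : ∀ {n z} → φ≤ n z → φ≤ n (conj z)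
  φ≤-conj (k , k≤n , r) = k , k≤n , Rep-conj r

  φ≤-step : ∀ {n v} d → φ≤ n v → φ≤ (suc n) (digit d +ᵍ 1+iᵍ *ᵍ v)
  φ≤-step d (k , k≤n , r) = suc k , s≤s k≤n , Rep-step d r

  φ≤-shift : ∀ {n v} → φ≤ n v → φ≤ (suc n) (1+iᵍ *ᵍ v)
  φ≤-shift (k , k≤n , r) = suc k , s≤s k≤n , Rep-shift r

  φ≤-double : ∀ {n a b} → φ≤ n (a + b i) → φ≤ (suc (suc n)) ((a + a) + (b + b) i)
  φ≤-double (k , k≤n , r) = suc (suc k) , s≤s (s≤s k≤n) , Rep-double r

  φ≤-swap : ∀ {n x y} → φ≤ n (y + x i) → φ≤ n (x + y i)
  φ≤-swap {x = x} {y} h =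
    subst (φ≤ _) (trans (i*ᵍ y (- x)) (cong (_+ y i) (ℤP.neg-involutive x))) (φ≤-unit ui (φ≤-conj h))

  φ≤-conj⁻¹ : ∀ {n x y} → φ≤ n (x + (- y) i) → φ≤ n (x + y i)
  φ≤-conj⁻¹ {x = x} {y} h = subst (φ≤ _) (cong (x +_i) (ℤP.neg-involutive y)) (φ≤-conj h)

  _≟ᵍ_ : (p q : ℤ[i]) → Dec (p ≡ q)
  (a + b i) ≟ᵍ (c + d i) with a ℤP.≟ c | b ℤP.≟ d
  ... | yes refl | yes refl = yes refl
  ... | no a≢c | _ = no λ { refl → a≢c refl }
  ... | yes _ | no b≢d = no λ { refl → b≢d refl }

  ∃ᵘ? : (P : Unit → Set) → (∀ u → Dec (P u)) → Dec (Σ Unit P)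
  ∃ᵘ? P P? with P? u1 | P? u-1 | P? ui | P? u-i
  ... | yes p | _ | _ | _ = yes (u1 , p)
  ... | no _ | yes p | _ | _ = yes (u-1 , p)
  ... | no _ | no _ | yes p | _ = yes (ui , p)
  ... | no _ | no _ | no _ | yes p = yes (u-i , p)
  ... | no ¬p₁ | no ¬p₂ | no ¬p₃ | no ¬p₄ =
    no λ { (u1 , p) → ¬p₁ p ; (u-1 , p) → ¬p₂ p ; (ui , p) → ¬p₃ p ; (u-i , p) → ¬p₄ p }

  ∃ᵈ? : (P : Maybe Unit → Set) → (∀ d → Dec (P d)) → Dec (Σ (Maybe Unit) P)
  ∃ᵈ? P P? with P? nothing | ∃ᵘ? (λ u → P (just u)) (λ u → P? (just u))
  ... | yes p | _ = yes (nothing , p)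
  ... | no _ | yes (u , p) = yes (just u , p)
  ... | no ¬p₀ | no ¬p = no λ { (nothing , p) → ¬p₀ p ; (just u , p) → ¬p (u , p) }

  ∃ᵛ? : ∀ k (P : Vec (Maybe Unit) k → Set) → (∀ ds → Dec (P ds)) → Dec (Σ (Vec (Maybe Unit) k) P)
  ∃ᵛ? zero P P? with P? Vec.[]
  ... | yes p = yes (Vec.[] , p)
  ... | no ¬p = no λ { (Vec.[] , p) → ¬p p }
  ∃ᵛ? (suc k) P P?
    with ∃ᵈ? (λ d → Σ (Vec (Maybe Unit) k) (λ ds → P (d Vec.∷ ds)))
             (λ d → ∃ᵛ? k (λ ds → P (d Vec.∷ ds)) (λ ds → P? (d Vec.∷ ds)))
  ... | yes (d , ds , p) = yes (d Vec.∷ ds , p)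
  ... | no ¬p = no λ { (d Vec.∷ ds , p) → ¬p (d , ds , p) }

  Rep? : ∀ k z → Dec (Rep k z)
  Rep? k z = ∃ᵛ? k _ (λ ds → ∃ᵘ? _ (λ u → evalExp ds u ≟ᵍ z))

  φ≤? : ∀ n z → Dec (φ≤ n z)
  φ≤? zero z with Rep? zero z
  ... | yes r = yes (zero , z≤n , r)
  ... | no ¬r = no λ { (zero , _ , r) → ¬r r }
  φ≤? (suc n) z with φ≤? n z | Rep? (suc n) z
  ... | yes (k , k≤n , r) | _ = yes (k , ℕP.m≤n⇒m≤1+n k≤n , r)
  ... | no _ | yes r = yes (suc n , ℕP.≤-refl , r)
  ... | no ¬φ≤n | no ¬r = no λ { (k , k≤1+n , r) → ≤-suc-cases k≤1+n r }
    where
    ≤-suc-cases : ∀ {k} → k ℕ.≤ suc n → Rep k z → ⊥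
    ≤-suc-cases {k} k≤1+n r with ℕP.m≤n⇒m<n∨m≡n k≤1+n
    ... | inj₁ (s≤s k≤n) = ¬φ≤n (k , k≤n , r)
    ... | inj₂ refl = ¬r r

  φ≤⇒IsPhi : ∀ n z → φ≤ n z → ∃[ k ] k ℕ.≤ n × IsPhi z k
  φ≤⇒IsPhi zero z (_ , z≤n , r) = zero , z≤n , r , λ _ _ → z≤n
  φ≤⇒IsPhi (suc n) z (k , k≤1+n , r) with φ≤? n z
  ... | yes φ≤n with φ≤⇒IsPhi n z φ≤n
  ...   | j , j≤n , φ = j , ℕP.m≤n⇒m≤1+n j≤n , φ
  φ≤⇒IsPhi (suc n) z (k , k≤1+n , r) | no ¬φ≤n = suc n , ℕP.≤-refl , rep , minimal
    where
    rep : Rep (suc n) z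
    rep with ℕP.m≤n⇒m<n∨m≡n k≤1+n
    ... | inj₁ (s≤s k≤n) = ⊥-elim (¬φ≤n (k , k≤n , r))
    ... | inj₂ refl = r
    minimal : ∀ j → Rep j z → suc n ℕ.≤ j
    minimal j rj with ℕP.≤-<-connex j n
    ... | inj₁ j≤n = ⊥-elim (¬φ≤n (j , j≤n , rj))
    ... | inj₂ n<j = n<j

  -- The octagons

  record Octagon (a c x y : ℤ) : Set where
    constructor octagon
    field
      x≤ : x ≤ a
      -x≤ : - x ≤ a
      y≤ : y ≤ a
      -y≤ : - y ≤ a
      x+y≤ : x + y ≤ c
      x-y≤ : x - y ≤ c
      -x+y≤ : - x + y ≤ c
      -x-y≤ : - x - y ≤ c

  open Octagon

  Oct : ℕ → ℤ → ℤ → Set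
  Oct n = Octagon (w n) (w (suc n) - + 1)

  Octagon-mono : ∀ {a a′ c c′ x y} → a ≤ a′ → c ≤ c′ → Octagon a c x y → Octagon a′ c′ x y
  Octagon-mono a≤a′ c≤c′ (octagon h₁ h₂ h₃ h₄ h₅ h₆ h₇ h₈) =
    octagon (ℤP.≤-trans h₁ a≤a′) (ℤP.≤-trans h₂ a≤a′) (ℤP.≤-trans h₃ a≤a′) (ℤP.≤-trans h₄ a≤a′)
            (ℤP.≤-trans h₅ c≤c′) (ℤP.≤-trans h₆ c≤c′) (ℤP.≤-trans h₇ c≤c′) (ℤP.≤-trans h₈ c≤c′)

  Oct-mono : ∀ {k n x y} → k ℕ.≤ n → Oct k x y → Oct n x y
  Oct-mono k≤n = Octagon-mono (w-mono k≤n) (ℤP.+-monoˡ-≤ (- + 1) (w-mono (s≤s k≤n)))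

  Octagon-conj : ∀ {a c x y} → Octagon a c x y → Octagon a c x (- y)
  Octagon-conj {a} {c} {x} {y} (octagon h₁ h₂ h₃ h₄ h₅ h₆ h₇ h₈) =
    octagon h₁ h₂ h₄ (subst (_≤ a) (sym (ℤP.neg-involutive y)) h₃) h₆
            (subst (_≤ c) (cong (_+_ x) (sym (ℤP.neg-involutive y))) h₅) h₈
            (subst (_≤ c) (cong (_+_ (- x)) (sym (ℤP.neg-involutive y))) h₇)

  Octagon-swap : ∀ {a c x y} → Octagon a c x y → Octagon a c y x
  Octagon-swap {a} {c} {x} {y} (octagon h₁ h₂ h₃ h₄ h₅ h₆ h₇ h₈) =
    octagon h₃ h₄ h₁ h₂ (subst (_≤ c) (ℤP.+-comm x y) h₅) (subst (_≤ c) (ℤP.+-comm (- x) y) h₇)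
            (subst (_≤ c) (ℤP.+-comm x (- y)) h₆) (subst (_≤ c) (ℤP.+-comm (- x) (- y)) h₈)

  digit-Octagon : ∀ d → Octagon (+ 1) (+ 1) (re (digit d)) (im (digit d))
  digit-Octagon nothing =
    octagon ≤-by-decide ≤-by-decide ≤-by-decide ≤-by-decide ≤-by-decide ≤-by-decide ≤-by-decide ≤-by-decide
  digit-Octagon (just u1) =
    octagon ≤-by-decide ≤-by-decide ≤-by-decide ≤-by-decide ≤-by-decide ≤-by-decide ≤-by-decide ≤-by-decide
  digit-Octagon (just u-1) =
    octagon ≤-by-decide ≤-by-decide ≤-by-decide ≤-by-decide ≤-by-decide ≤-by-decide ≤-by-decide ≤-by-decide
  digit-Octagon (just ui) =
    octagon ≤-by-decide ≤-by-decide ≤-by-decide ≤-by-decide ≤-by-decide ≤-by-decide ≤-by-decide ≤-by-decide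
  digit-Octagon (just u-i) =
    octagon ≤-by-decide ≤-by-decide ≤-by-decide ≤-by-decide ≤-by-decide ≤-by-decide ≤-by-decide ≤-by-decide

  Octagon-digit-step : ∀ {dr di e₁ e₂ a a′} → Octagon (+ 1) (+ 1) dr di → Octagon a (a′ - + 1) e₁ e₂ →
    Octagon a′ (a + a + + 2 - + 1) (dr + (e₁ - e₂)) (di + (e₂ + e₁))
  Octagon-digit-step {dr} {di} {e₁} {e₂} {a} {a′} D E = octagon
    (≤-by-slack _ (slack (D .x≤) ⊕ slack (E .x-y≤)) (solve vars))
    (≤-by-slack _ (slack (D .-x≤) ⊕ slack (E .-x+y≤)) (solve vars))
    (≤-by-slack _ (slack (D .y≤) ⊕ slack (E .x+y≤)) (solve vars))
    (≤-by-slack _ (slack (D .-y≤) ⊕ slack (E .-x-y≤)) (solve vars))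
    (≤-by-slack _ (slack (D .x+y≤) ⊕ slack (E .x≤) ⊕ slack (E .x≤)) (solve vars))
    (≤-by-slack _ (slack (D .x-y≤) ⊕ slack (E .-y≤) ⊕ slack (E .-y≤)) (solve vars))
    (≤-by-slack _ (slack (D .-x+y≤) ⊕ slack (E .y≤) ⊕ slack (E .y≤)) (solve vars))
    (≤-by-slack _ (slack (D .-x-y≤) ⊕ slack (E .-x≤) ⊕ slack (E .-x≤)) (solve vars))
    where
    vars = dr ∷ di ∷ e₁ ∷ e₂ ∷ a ∷ a′ ∷ []

  evalExp-Oct : ∀ {k} (ds : Vec (Maybe Unit) k) u → Oct k (re (evalExp ds u)) (im (evalExp ds u))
  evalExp-Oct Vec.[] u = digit-Octagon (just u)
  evalExp-Oct {suc k} (d Vec.∷ ds) u =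
    subst₂ (Oct (suc k)) (cong re expand) (cong im expand) (Octagon-digit-step (digit-Octagon d) (evalExp-Oct ds u))
    where
    e = evalExp ds u
    expand : digit d +ᵍ ((re e - im e) + (im e + re e) i) ≡ digit d +ᵍ 1+iᵍ *ᵍ e
    expand = cong (digit d +ᵍ_) (sym (1+i*ᵍ (re e) (im e)))

  φ≤⇒Oct : ∀ {n z} → φ≤ n z → Oct n (re z) (im z)
  φ≤⇒Oct (k , k≤n , ds , u , refl) = Oct-mono k≤n (evalExp-Oct ds u)

  -- Points of an octagon that are not divisible by 2

  NotBothEven : ℤ → ℤ → Set
  NotBothEven x y = Odd (x + y) ⊎ (Odd x × Odd y)

  parity-cases : ∀ x y → (Even x × Even y) ⊎ NotBothEven x y
  parity-cases x y with even-or-odd x | even-or-odd y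
  ... | inj₁ ex | inj₁ ey = inj₁ (ex , ey)
  ... | inj₁ ex | inj₂ oy = inj₂ (inj₁ (subst Odd (ℤP.+-comm y x) (Odd+Even oy ex)))
  ... | inj₂ ox | inj₁ ey = inj₂ (inj₁ (Odd+Even ox ey))
  ... | inj₂ ox | inj₂ oy = inj₂ (inj₂ (ox , oy))

  ≡0-by-bounds : ∀ {y} → y ≤ + 0 → - y ≤ + 0 → y ≡ + 0
  ≡0-by-bounds {y} y≤0 -y≤0 = ℤP.≤-antisym y≤0 (subst (+ 0 ≤_) (ℤP.neg-involutive y) (ℤP.neg-mono-≤ -y≤0))

  ∣∣≤1-cases : ∀ x → x ≤ + 1 → - x ≤ + 1 → x ≡ - + 1 ⊎ x ≡ + 0 ⊎ x ≡ + 1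
  ∣∣≤1-cases (+ zero) _ _ = inj₂ (inj₁ refl)
  ∣∣≤1-cases (+ suc zero) _ _ = inj₂ (inj₂ refl)
  ∣∣≤1-cases (+ suc (suc n)) (+≤+ (s≤s ())) _
  ∣∣≤1-cases -[1+ zero ] _ _ = inj₁ refl
  ∣∣≤1-cases -[1+ suc n ] _ (+≤+ (s≤s ()))

  squeeze : ∀ y → + 1 + y ≤ + 1 → + 1 - y ≤ + 1 → y ≡ + 0
  squeeze y h₁ h₂ = ≡0-by-bounds (≤-by-slack _ (slack h₁) (solve (y ∷ []))) (≤-by-slack _ (slack h₂) (solve (y ∷ [])))

  φ≤0-unit : ∀ u → φ≤ 0 (unit u)
  φ≤0-unit u = zero , z≤n , Vec.[] , u , refl

  OddSumSufficient : ℕ → Set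
  OddSumSufficient n = ∀ x y → Odd (x + y) → Oct n x y → φ≤ n (x + y i)

  Odd-sum-Oct₀⇒φ≤ : OddSumSufficient 0
  Odd-sum-Oct₀⇒φ≤ x y odd B with ∣∣≤1-cases x (B .x≤) (B .-x≤)
  ... | inj₁ refl with squeeze y (B .-x+y≤) (B .-x-y≤)
  ...   | refl = φ≤0-unit u-1
  Odd-sum-Oct₀⇒φ≤ x y odd B | inj₂ (inj₂ refl) with squeeze y (B .x+y≤) (B .x-y≤)
  ...   | refl = φ≤0-unit u1
  Odd-sum-Oct₀⇒φ≤ x y odd B | inj₂ (inj₁ refl) with ∣∣≤1-cases y (B .y≤) (B .-y≤)
  ...   | inj₁ refl = φ≤0-unit u-i
  ...   | inj₂ (inj₁ refl) = ⊥-elim (¬Even∧Odd (+ 0 , refl) odd)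
  ...   | inj₂ (inj₂ refl) = φ≤0-unit ui

  -- z = i + (1+i)·((a + b) + (b − a − 1) i) for z = (2a + 1) + 2b i.
  odd-even-predecessor : ∀ v v′ a b → Even v′ → v′ ≤ v + v → + 2 ≤ v′ → + 0 ≤ b + b →
    Octagon v′ (v + v + + 2 - + 1) (a + a + + 1) (b + b) → Octagon v (v′ - + 1) (a + b) (b - a - + 1)
  odd-even-predecessor v v′ a b (h , refl) v′≤2v 2≤v′ 0≤2b B = octagon
    (half-≤ _ _ (≤-by-slack _ (slack (B .x+y≤) ⊕ nonneg 1) (solve vars)))
    (half-≤ _ _ (≤-by-slack _ (slack v′≤2v ⊕ slack 1-x≤v′ ⊕ slack 0≤2b ⊕ nonneg 1) (solve vars)))
    (half-≤ _ _ (≤-by-slack _ (slack (B .-x+y≤) ⊕ nonneg 1) (solve vars)))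
    (half-≤ _ _ (≤-by-slack _ (slack v′≤2v ⊕ slack x+1≤v′ ⊕ slack 0≤2b ⊕ nonneg 1) (solve vars)))
    (≤-by-slack _ (slack (B .y≤)) (solve vars))
    (≤-by-slack _ (slack x+1≤v′) (solve vars))
    (≤-by-slack _ (slack 1-x≤v′) (solve vars))
    (≤-by-slack _ (slack 2≤v′ ⊕ slack 0≤2b) (solve vars))
    where
    vars = a ∷ b ∷ v ∷ h ∷ []
    x+1≤v′ : a + a + + 1 + + 1 ≤ h + h
    x+1≤v′ = Odd≤Even⇒< {h = h} (a , refl) (B .x≤)
    1-x≤v′ : - (a + a + + 1) + + 1 ≤ h + h
    1-x≤v′ = Odd≤Even⇒< {h = h} (Odd-neg (a , refl)) (B .-x≤)

  odd-even-nonneg-Oct⇒φ≤ : ∀ n → OddSumSufficient n → ∀ a b → + 0 ≤ b + b →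
    Oct (suc n) (a + a + + 1) (b + b) → φ≤ (suc n) ((a + a + + 1) + (b + b) i)
  odd-even-nonneg-Oct⇒φ≤ n ih a b 0≤2b B = subst (φ≤ (suc n)) expand (φ≤-step (just ui) (ih _ _ odd-sum
      (odd-even-predecessor (w n) (w (suc n)) a b (w-suc-even n) (w-suc≤2w n) (2≤w-suc n) 0≤2b B)))
    where
    odd-sum : Odd ((a + b) + (b - a - + 1))
    odd-sum = b - + 1 , solve (a ∷ b ∷ [])
    expand : digit (just ui) +ᵍ 1+iᵍ *ᵍ ((a + b) + (b - a - + 1) i) ≡ (a + a + + 1) + (b + b) i
    expand = trans (cong (unit ui +ᵍ_) (1+i*ᵍ (a + b) (b - a - + 1)))
                   (cong₂ _+_i (solve (a ∷ b ∷ [])) (solve (a ∷ b ∷ [])))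

  odd-even-Oct⇒φ≤ : ∀ n → OddSumSufficient n → ∀ {x y} → Odd x → Even y → Oct (suc n) x y → φ≤ (suc n) (x + y i)
  odd-even-Oct⇒φ≤ n ih (a , refl) (b , refl) B with ℤP.≤-total (+ 0) (b + b)
  ... | inj₁ 0≤2b = odd-even-nonneg-Oct⇒φ≤ n ih a b 0≤2b B
  ... | inj₂ 2b≤0 =
    φ≤-conj⁻¹ (subst (λ t → φ≤ (suc n) ((a + a + + 1) + t i)) (sym (neg-double b))
      (odd-even-nonneg-Oct⇒φ≤ n ih a (- b) (≤-by-slack _ (slack 2b≤0) (solve (b ∷ [])))
        (subst (Oct (suc n) _) (neg-double b) (Octagon-conj B))))
    where
    neg-double : ∀ b → - (b + b) ≡ - b + - b
    neg-double = solve-∀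

  Odd-sum-Oct⇒φ≤ : ∀ n → OddSumSufficient n
  Odd-sum-Oct⇒φ≤ zero = Odd-sum-Oct₀⇒φ≤
  Odd-sum-Oct⇒φ≤ (suc n) x y odd B with even-or-odd x
  ... | inj₂ odd-x = odd-even-Oct⇒φ≤ n (Odd-sum-Oct⇒φ≤ n) odd-x (Odd-cancelˡ odd odd-x) B
  ... | inj₁ even-x =
    φ≤-swap (odd-even-Oct⇒φ≤ n (Odd-sum-Oct⇒φ≤ n) (Even-cancelˡ odd even-x) even-x (Octagon-swap B))

  -- z = (1+i)·((a + b + 1) + (b − a) i) for z = (2a + 1) + (2b + 1) i.
  both-odd-predecessor : ∀ v v′ a b → Even v′ →
    Octagon v′ (v + v + + 2 - + 1) (a + a + + 1) (b + b + + 1) → Octagon v (v′ - + 1) (a + b + + 1) (b - a)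
  both-odd-predecessor v v′ a b (h , refl) B = octagon
    (half-≤ _ _ (≤-by-slack _ (slack (B .x+y≤)) (solve vars)))
    (half-≤ _ _ (≤-by-slack _ (slack (B .-x-y≤)) (solve vars)))
    (half-≤ _ _ (≤-by-slack _ (slack (B .-x+y≤)) (solve vars)))
    (half-≤ _ _ (≤-by-slack _ (slack (B .x-y≤)) (solve vars)))
    (≤-by-slack _ (slack (strict (b , refl) (B .y≤))) (solve vars))
    (≤-by-slack _ (slack (strict (a , refl) (B .x≤))) (solve vars))
    (≤-by-slack _ (slack (strict (Odd-neg (a , refl)) (B .-x≤))) (solve vars))
    (≤-by-slack _ (slack (strict (Odd-neg (b , refl)) (B .-y≤))) (solve vars))
    where
    vars = a ∷ b ∷ v ∷ h ∷ []
    strict : ∀ {x} → Odd x → x ≤ h + h → x + + 1 ≤ h + h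
    strict = Odd≤Even⇒< {h = h}

  both-odd-∉Oct₀ : ∀ a b → ¬ Oct 0 (a + a + + 1) (b + b + + 1)
  both-odd-∉Oct₀ a b B = ¬Even∧Odd (+ 0 , refl) (subst Odd 2a+1≡0 (a , refl))
    where
    a+b+1≤0 : a + b + + 1 ≤ + 0
    a+b+1≤0 = half-≤ _ _ (≤-by-slack _ (slack (B .x+y≤)) (solve (a ∷ b ∷ [])))
    -[a+b+1]≤0 : - (a + b + + 1) ≤ + 0
    -[a+b+1]≤0 = half-≤ _ _ (≤-by-slack _ (slack (B .-x-y≤)) (solve (a ∷ b ∷ [])))
    a-b≤0 : a - b ≤ + 0
    a-b≤0 = half-≤ _ _ (≤-by-slack _ (slack (B .x-y≤)) (solve (a ∷ b ∷ [])))
    -[a-b]≤0 : - (a - b) ≤ + 0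
    -[a-b]≤0 = half-≤ _ _ (≤-by-slack _ (slack (B .-x+y≤)) (solve (a ∷ b ∷ [])))
    2a+1≡0 : a + a + + 1 ≡ + 0
    2a+1≡0 = ≡0-by-bounds (≤-by-slack _ (slack a+b+1≤0 ⊕ slack a-b≤0) (solve (a ∷ b ∷ [])))
                          (≤-by-slack _ (slack -[a+b+1]≤0 ⊕ slack -[a-b]≤0) (solve (a ∷ b ∷ [])))

  both-odd-Oct⇒φ≤ : ∀ n a b → Oct n (a + a + + 1) (b + b + + 1) → φ≤ n ((a + a + + 1) + (b + b + + 1) i)
  both-odd-Oct⇒φ≤ zero a b B = ⊥-elim (both-odd-∉Oct₀ a b B)
  both-odd-Oct⇒φ≤ (suc n) a b B = subst (φ≤ (suc n)) expand (φ≤-shift (Odd-sum-Oct⇒φ≤ n _ _ odd-sum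
      (both-odd-predecessor (w n) (w (suc n)) a b (w-suc-even n) B)))
    where
    odd-sum : Odd ((a + b + + 1) + (b - a))
    odd-sum = b , solve (a ∷ b ∷ [])
    expand : 1+iᵍ *ᵍ ((a + b + + 1) + (b - a) i) ≡ (a + a + + 1) + (b + b + + 1) i
    expand = trans (1+i*ᵍ (a + b + + 1) (b - a)) (cong₂ _+_i (solve (a ∷ b ∷ [])) (solve (a ∷ b ∷ [])))

  NotBothEven-Oct⇒φ≤ : ∀ n {x y} → NotBothEven x y → Oct n x y → φ≤ n (x + y i)
  NotBothEven-Oct⇒φ≤ n (inj₁ odd) B = Odd-sum-Oct⇒φ≤ n _ _ odd B
  NotBothEven-Oct⇒φ≤ n (inj₂ ((a , refl) , (b , refl))) B = both-odd-Oct⇒φ≤ n a b B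

  -- Two regions lying entirely in {φ ≤ n}

  Octagon-quadrant : ∀ x y a c → + 0 ≤ x → + 0 ≤ y → x ≤ a → y ≤ a → x + y ≤ c → Octagon a c x y
  Octagon-quadrant x y a c 0≤x 0≤y x≤a y≤a x+y≤c = octagon
    x≤a
    (≤-by-slack _ (slack x≤a ⊕ slack 0≤x ⊕ slack 0≤x) (solve vars))
    y≤a
    (≤-by-slack _ (slack y≤a ⊕ slack 0≤y ⊕ slack 0≤y) (solve vars))
    x+y≤c
    (≤-by-slack _ (slack x+y≤c ⊕ slack 0≤y ⊕ slack 0≤y) (solve vars))
    (≤-by-slack _ (slack x+y≤c ⊕ slack 0≤x ⊕ slack 0≤x) (solve vars))
    (≤-by-slack _ (slack x+y≤c ⊕ slack 0≤x ⊕ slack 0≤x ⊕ slack 0≤y ⊕ slack 0≤y) (solve vars))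
    where
    vars = x ∷ y ∷ a ∷ c ∷ []

  mutual
    diamond⇒φ≤ : ∀ n x y → + 0 ≤ x → + 0 ≤ y → + 1 ≤ x + y → x + y + + 1 ≤ 2^⌊ n /2⌋ + 2^⌊ n /2⌋ →
      φ≤ n (x + y i)
    diamond⇒φ≤ n x y 0≤x 0≤y 1≤x+y x+y<2P with parity-cases x y
    ... | inj₂ nbe = NotBothEven-Oct⇒φ≤ n nbe
      (Octagon-quadrant x y (w n) (w (suc n) - + 1) 0≤x 0≤y
        (ℤP.≤-trans (≤+nonneg x 0≤y) x+y≤w) (ℤP.≤-trans (≤+nonnegˡ y 0≤x) x+y≤w)
        (ℤP.≤-trans x+y≤2P-1 (2^⌊/2⌋-double-1≤w-suc-1 n)))
      where
      x+y≤2P-1 : x + y ≤ 2^⌊ n /2⌋ + 2^⌊ n /2⌋ - + 1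
      x+y≤2P-1 = +1≤⇒≤-1 x+y<2P
      x+y≤w : x + y ≤ w n
      x+y≤w = ℤP.≤-trans x+y≤2P-1 (2^⌊/2⌋-double-1≤w n)
    ... | inj₁ ((p , refl) , (q , refl)) = double-diamond⇒φ≤ n p q 0≤x 0≤y 1≤x+y x+y<2P

    double-diamond⇒φ≤ : ∀ n p q → + 0 ≤ p + p → + 0 ≤ q + q → + 1 ≤ (p + p) + (q + q) →
      (p + p) + (q + q) + + 1 ≤ 2^⌊ n /2⌋ + 2^⌊ n /2⌋ → φ≤ n ((p + p) + (q + q) i)
    double-diamond⇒φ≤ zero p q _ _ 1≤2s 2s<2 = ⊥-elim (no-double-below-2 p q 1≤2s 2s<2)
    double-diamond⇒φ≤ (suc zero) p q _ _ 1≤2s 2s<2 = ⊥-elim (no-double-below-2 p q 1≤2s 2s<2)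
    double-diamond⇒φ≤ (suc (suc n)) p q 0≤2p 0≤2q 1≤2s 2s<4P =
      φ≤-double (diamond⇒φ≤ n p q (double-nonneg⁻¹ p 0≤2p) (double-nonneg⁻¹ q 0≤2q)
        (double-pos⁻¹ (p + q) (≤-by-slack _ (slack 1≤2s) (solve (p ∷ q ∷ []))))
        (halve (2^⌊ n /2⌋) 2s<4P))
      where
      halve : ∀ P → (p + p) + (q + q) + + 1 ≤ (P + P) + (P + P) → p + q + + 1 ≤ P + P
      halve P h = ≤-by-slack _ (slack (half-≤ (p + q) (P + P - + 1) (≤-by-slack _ (slack h) (solve (p ∷ q ∷ P ∷ [])))))
                    (solve (p ∷ q ∷ P ∷ []))

    no-double-below-2 : ∀ p q → + 1 ≤ (p + p) + (q + q) → ¬ ((p + p) + (q + q) + + 1 ≤ + 1 + + 1)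
    no-double-below-2 p q 1≤2s 2s<2 = 1≰0 (ℤP.≤-trans
      (double-pos⁻¹ (p + q) (≤-by-slack _ (slack 1≤2s) (solve (p ∷ q ∷ []))))
      (half-≤ (p + q) (+ 0) (≤-by-slack _ (slack 2s<2) (solve (p ∷ q ∷ [])))))

  mutual
    strip⇒φ≤ : ∀ n x y → + 1 ≤ y → y ≤ x → y + + 1 ≤ 2^⌈ n /2⌉ → x + y ≤ w n + + 1 → φ≤ n (x + y i)
    strip⇒φ≤ n x y 1≤y y≤x y<P x+y≤w+1 with parity-cases x y
    strip⇒φ≤ zero x y 1≤y _ y<1 _ | inj₂ _ =
      ⊥-elim (1≰0 (ℤP.≤-trans 1≤y (+1≤+1⇒≤ {y} {+ 0} y<1)))
    strip⇒φ≤ (suc n) x y 1≤y y≤x _ x+y≤w+1 | inj₂ nbe = NotBothEven-Oct⇒φ≤ (suc n) nbe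
      (Octagon-quadrant x y (w (suc n)) (w (suc (suc n)) - + 1) 0≤x 0≤y x≤w (ℤP.≤-trans y≤x x≤w) x+y≤w″-1)
      where
      0≤y = ℤP.≤-trans ≤-by-decide 1≤y
      0≤x = ℤP.≤-trans 0≤y y≤x
      x≤w : x ≤ w (suc n)
      x≤w = +1≤+1⇒≤ {x} {w (suc n)} (ℤP.≤-trans (ℤP.+-monoʳ-≤ x 1≤y) x+y≤w+1)
      x+y≤w″-1 : x + y ≤ w (suc (suc n)) - + 1
      x+y≤w″-1 = +1≤⇒≤-1 (ℤP.≤-trans (ℤP.+-monoˡ-≤ (+ 1) x+y≤w+1) (+1-mono-+2 {w (suc n)} (w+2≤w-suc n)))
    strip⇒φ≤ n _ _ 1≤y y≤x y<P x+y≤w+1 | inj₁ ((p , refl) , (q , refl)) =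
      double-strip⇒φ≤ n p q 1≤y y≤x y<P x+y≤w+1

    double-strip⇒φ≤ : ∀ n p q → + 1 ≤ q + q → q + q ≤ p + p → q + q + + 1 ≤ 2^⌈ n /2⌉ →
      (p + p) + (q + q) ≤ w n + + 1 → φ≤ n ((p + p) + (q + q) i)
    double-strip⇒φ≤ zero p q 1≤2q _ 2q<1 _ =
      ⊥-elim (1≰0 (ℤP.≤-trans 1≤2q (+1≤+1⇒≤ {q + q} {+ 0} 2q<1)))
    double-strip⇒φ≤ (suc zero) p q 1≤2q _ 2q<2 _ =
      ⊥-elim (1≰0 (ℤP.≤-trans (double-pos⁻¹ q 1≤2q) (half-≤ q (+ 0) (≤-by-slack _ (slack 2q<2) (solve (q ∷ []))))))
    double-strip⇒φ≤ (suc (suc n)) p q 1≤2q 2q≤2p 2q<2P 2s≤2w+3 =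
      φ≤-double (strip⇒φ≤ n p q (double-pos⁻¹ q 1≤2q) (double-cancel-≤ q p 2q≤2p)
        (halve-height (2^⌈ n /2⌉) 2q<2P) (halve-sum (w n) 2s≤2w+3))
      where
      halve-height : ∀ P → q + q + + 1 ≤ P + P → q + + 1 ≤ P
      halve-height P h = ≤-by-slack _ (slack (half-≤ q (P - + 1) (≤-by-slack _ (slack h) (solve (q ∷ P ∷ [])))))
                           (solve (q ∷ P ∷ []))
      halve-sum : ∀ a → (p + p) + (q + q) ≤ a + a + + 2 + + 1 → p + q ≤ a + + 1
      halve-sum a h = half-≤ (p + q) (a + + 1) (≤-by-slack _ (slack h) (solve (p ∷ q ∷ a ∷ [])))

  -- Halving

  isUnitℤ : ℤ → Bool
  isUnitℤ (+ zero) = false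
  isUnitℤ (+ suc zero) = true
  isUnitℤ (+ suc (suc n)) = false
  isUnitℤ -[1+ zero ] = true
  isUnitℤ -[1+ suc n ] = false

  isUnitℤ⇒¬Even : ∀ x → isUnitℤ x ≡ true → ¬ Even x
  isUnitℤ⇒¬Even (+ suc zero) refl even = ¬Even∧Odd even (+ 0 , refl)
  isUnitℤ⇒¬Even -[1+ zero ] refl even = ¬Even∧Odd even (- + 1 , refl)

  hasUnitCoord : ℤ[i] → Bool
  hasUnitCoord z = isUnitℤ (re z) ∨ isUnitℤ (im z)

  hasUnitCoord⇒¬double : ∀ z → hasUnitCoord z ≡ true → Even (re z) → Even (im z) → ⊥
  hasUnitCoord⇒¬double z has even-re even-im with isUnitℤ (re z) in eq
  ... | true = isUnitℤ⇒¬Even (re z) eq even-re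
  ... | false = isUnitℤ⇒¬Even (im z) has even-im

  unit-hasUnitCoord : ∀ u → hasUnitCoord (unit u) ≡ true
  unit-hasUnitCoord u1 = refl
  unit-hasUnitCoord u-1 = refl
  unit-hasUnitCoord ui = refl
  unit-hasUnitCoord u-i = refl

  twoDigits-hasUnitCoord : ∀ d u → hasUnitCoord (digit d +ᵍ 1+iᵍ *ᵍ unit u) ≡ true
  twoDigits-hasUnitCoord nothing u1 = refl
  twoDigits-hasUnitCoord nothing u-1 = refl
  twoDigits-hasUnitCoord nothing ui = refl
  twoDigits-hasUnitCoord nothing u-i = refl
  twoDigits-hasUnitCoord (just u1) u1 = refl
  twoDigits-hasUnitCoord (just u1) u-1 = refl
  twoDigits-hasUnitCoord (just u1) ui = refl
  twoDigits-hasUnitCoord (just u1) u-i = refl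
  twoDigits-hasUnitCoord (just u-1) u1 = refl
  twoDigits-hasUnitCoord (just u-1) u-1 = refl
  twoDigits-hasUnitCoord (just u-1) ui = refl
  twoDigits-hasUnitCoord (just u-1) u-i = refl
  twoDigits-hasUnitCoord (just ui) u1 = refl
  twoDigits-hasUnitCoord (just ui) u-1 = refl
  twoDigits-hasUnitCoord (just ui) ui = refl
  twoDigits-hasUnitCoord (just ui) u-i = refl
  twoDigits-hasUnitCoord (just u-i) u1 = refl
  twoDigits-hasUnitCoord (just u-i) u-1 = refl
  twoDigits-hasUnitCoord (just u-i) ui = refl
  twoDigits-hasUnitCoord (just u-i) u-i = refl

  lowDigits-cases : ∀ d₀ d₁ → (d₀ ≡ nothing × d₁ ≡ nothing) ⊎ hasUnitCoord (digit d₀ +ᵍ 1+iᵍ *ᵍ digit d₁) ≡ true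
  lowDigits-cases nothing nothing = inj₁ (refl , refl)
  lowDigits-cases d₀ (just u) = inj₂ (twoDigits-hasUnitCoord d₀ u)
  lowDigits-cases (just u1) nothing = inj₂ refl
  lowDigits-cases (just u-1) nothing = inj₂ refl
  lowDigits-cases (just ui) nothing = inj₂ refl
  lowDigits-cases (just u-i) nothing = inj₂ refl

  +ᵍ-assoc : ∀ p q r → p +ᵍ (q +ᵍ r) ≡ (p +ᵍ q) +ᵍ r
  +ᵍ-assoc (a + b i) (c + d i) (e + f i) = cong₂ _+_i (sym (ℤP.+-assoc a c e)) (sym (ℤP.+-assoc b d f))

  [1+i]²*ᵍ : ∀ a b → 1+iᵍ *ᵍ (1+iᵍ *ᵍ (a + b i)) ≡ (- b - b) + (a + a) i
  [1+i]²*ᵍ a b = trans (cong (1+iᵍ *ᵍ_) (1+i*ᵍ a b))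
    (trans (1+i*ᵍ (a - b) (b + a)) (cong₂ _+_i (solve (a ∷ b ∷ [])) (solve (a ∷ b ∷ []))))

  evalExp-low-digits : ∀ {k} d₀ d₁ (ds : Vec (Maybe Unit) k) u → let v = evalExp ds u in
    evalExp (d₀ Vec.∷ d₁ Vec.∷ ds) u ≡ (digit d₀ +ᵍ 1+iᵍ *ᵍ digit d₁) +ᵍ ((- im v - im v) + (re v + re v) i)
  evalExp-low-digits d₀ d₁ ds u = begin
    digit d₀ +ᵍ 1+iᵍ *ᵍ (digit d₁ +ᵍ 1+iᵍ *ᵍ v)
      ≡⟨ cong (digit d₀ +ᵍ_) (*ᵍ-distribˡ-+ᵍ 1+iᵍ (digit d₁) (1+iᵍ *ᵍ v)) ⟩
    digit d₀ +ᵍ (1+iᵍ *ᵍ digit d₁ +ᵍ 1+iᵍ *ᵍ (1+iᵍ *ᵍ v))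
      ≡⟨ cong (λ t → digit d₀ +ᵍ (1+iᵍ *ᵍ digit d₁ +ᵍ t)) ([1+i]²*ᵍ (re v) (im v)) ⟩
    digit d₀ +ᵍ (1+iᵍ *ᵍ digit d₁ +ᵍ ((- im v - im v) + (re v + re v) i))
      ≡⟨ +ᵍ-assoc (digit d₀) _ _ ⟩
    (digit d₀ +ᵍ 1+iᵍ *ᵍ digit d₁) +ᵍ ((- im v - im v) + (re v + re v) i)
      ∎
    where
    v = evalExp ds u

  Even-cancelʳ : ∀ x y s → x + (y + y) ≡ s + s → Even x
  Even-cancelʳ x y s eq = s - y , trans (+-cancelʳ-≡ x (y + y) eq) (solve (y ∷ s ∷ []))

  halve-unit-multiple : ∀ v {p q} → 0ᵍ +ᵍ ((- im v - im v) + (re v + re v) i) ≡ (p + p) + (q + q) i →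
    unit ui *ᵍ v ≡ p + q i
  halve-unit-multiple v eq = trans (i*ᵍ (re v) (im v)) (cong₂ _+_i
    (double-injective (trans (sym (ℤP.+-identityˡ _)) (cong re eq)))
    (double-injective (trans (sym (ℤP.+-identityˡ _)) (cong im eq))))

  -- (1+i)² = 2i, so the two lowest digits of a multiple of 2 vanish.
  Rep-halve : ∀ {k p q} → Rep k ((p + p) + (q + q) i) → ∃[ k′ ] k ≡ suc (suc k′) × Rep k′ (p + q i)
  Rep-halve {p = p} {q} (Vec.[] , u , eq) =
    ⊥-elim (hasUnitCoord⇒¬double (unit u) (unit-hasUnitCoord u) (p , cong re eq) (q , cong im eq))
  Rep-halve {p = p} {q} (d Vec.∷ Vec.[] , u , eq) =
    ⊥-elim (hasUnitCoord⇒¬double _ (twoDigits-hasUnitCoord d u) (p , cong re eq) (q , cong im eq))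
  Rep-halve {suc (suc k)} {p} {q} (d₀ Vec.∷ d₁ Vec.∷ ds , u , eq)
    with lowDigits-cases d₀ d₁ | trans (sym (evalExp-low-digits d₀ d₁ ds u)) eq
  ... | inj₁ (refl , refl) | split =
    k , refl , subst (Rep k) (halve-unit-multiple (evalExp ds u) split) (Rep-unit ui (ds , u , refl))
  ... | inj₂ has | split = ⊥-elim (hasUnitCoord⇒¬double e has
      (Even-cancelʳ (re e) (- im (evalExp ds u)) p (cong re split))
      (Even-cancelʳ (im e) (re (evalExp ds u)) q (cong im split)))
    where
    e = digit d₀ +ᵍ 1+iᵍ *ᵍ digit d₁

  Rep₀-on-axis : ∀ {z} → Rep 0 z → re z ≡ + 0 ⊎ im z ≡ + 0
  Rep₀-on-axis (Vec.[] , u1 , refl) = inj₂ refl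
  Rep₀-on-axis (Vec.[] , u-1 , refl) = inj₂ refl
  Rep₀-on-axis (Vec.[] , ui , refl) = inj₁ refl
  Rep₀-on-axis (Vec.[] , u-i , refl) = inj₁ refl

  -- The lemma in normalised coordinates

  record Config (Lb mb Lr mr : ℤ) : Set where
    field
      1≤mr : + 1 ≤ mr
      mr≤Lr : mr ≤ Lr
      Lr≤mb : Lr ≤ mb
      mb≤Lb : mb ≤ Lb
      off-diagonal : Lb ≡ mb → Lr ≢ mr

  open Config

  module _ {Lb mb Lr mr} (C : Config Lb mb Lr mr) where

    0≤mr : + 0 ≤ mr
    0≤mr = ℤP.≤-trans ≤-by-decide (C .1≤mr)

    0≤Lr : + 0 ≤ Lr
    0≤Lr = ℤP.≤-trans 0≤mr (C .mr≤Lr)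

    1≤mb : + 1 ≤ mb
    1≤mb = ℤP.≤-trans (C .1≤mr) (ℤP.≤-trans (C .mr≤Lr) (C .Lr≤mb))

    1≤Lr+mr : + 1 ≤ Lr + mr
    1≤Lr+mr = ℤP.≤-trans (C .1≤mr) (≤+nonnegˡ mr 0≤Lr)

    W-re-nonneg : + 0 ≤ mb - Lr
    W-re-nonneg = slack (C .Lr≤mb)

    W-im-nonneg : + 0 ≤ Lb - mr
    W-im-nonneg = slack (ℤP.≤-trans (C .mr≤Lr) (ℤP.≤-trans (C .Lr≤mb) (C .mb≤Lb)))

    W-re≤W-im : mb - Lr ≤ Lb - mr
    W-re≤W-im = ≤-by-slack _ (slack (C .mb≤Lb) ⊕ slack (C .mr≤Lr)) (solve (Lb ∷ mb ∷ Lr ∷ mr ∷ []))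

    W-sum-pos : + 1 ≤ (mb - Lr) + (Lb - mr)
    W-sum-pos with + 1 ℤP.≤? (mb - Lr) + (Lb - mr)
    ... | yes 1≤W = 1≤W
    ... | no 1≰W = ⊥-elim (C .off-diagonal (ℤP.≤-antisym Lb≤mb (C .mb≤Lb)) (ℤP.≤-antisym Lr≤mr (C .mr≤Lr)))
      where
      W≤0 : (mb - Lr) + (Lb - mr) ≤ + 0
      W≤0 = +1≤+1⇒≤ {(mb - Lr) + (Lb - mr)} {+ 0} (≰⇒+1≤ 1≰W)
      vars = Lb ∷ mb ∷ Lr ∷ mr ∷ []
      Lb≤mb : Lb ≤ mb
      Lb≤mb = ≤-by-slack _ (slack W≤0 ⊕ slack (C .Lr≤mb) ⊕ slack (C .Lr≤mb) ⊕ slack (C .mr≤Lr)) (solve vars)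
      Lr≤mr : Lr ≤ mr
      Lr≤mr = ≤-by-slack _ (slack W≤0 ⊕ slack (C .mb≤Lb) ⊕ slack (C .Lr≤mb) ⊕ slack (C .Lr≤mb)) (solve vars)

  W-sum-bound : ∀ Lb mb Lr mr a Q → Lb + mb ≤ a + Q - + 1 → a ≤ Lr + mr → (mb - Lr) + (Lb - mr) + + 1 ≤ Q
  W-sum-bound Lb mb Lr mr a Q h₁ h₂ = ≤-by-slack _ (slack h₁ ⊕ slack h₂) (solve (Lb ∷ mb ∷ Lr ∷ mr ∷ a ∷ Q ∷ []))

  smaller-half : ∀ L m a → m ≤ L → L + m ≤ a + a + + 2 - + 1 → m ≤ a
  smaller-half L m a m≤L h = half-≤ m a (≤-by-slack _ (slack h ⊕ slack m≤L) (solve (L ∷ m ∷ a ∷ [])))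

  new-remainder-φ≤-r-NotBothEven : ∀ N {Lb mb Lr mr} → Config Lb mb Lr mr → Oct (suc N) Lb mb →
    ¬ φ≤ N (Lr + mr i) → NotBothEven Lr mr → φ≤ N ((mb - Lr) + (Lb - mr) i)
  new-remainder-φ≤-r-NotBothEven N {Lb} {mb} {Lr} {mr} C B r∉ nbe =
    diamond⇒φ≤ N (mb - Lr) (Lb - mr) (W-re-nonneg C) (W-im-nonneg C) (W-sum-pos C)
      (W-sum-bound Lb mb Lr mr (w (suc N)) _ (subst (λ t → Lb + mb ≤ t - + 1) (w-suc-suc N) (B .x+y≤)) w′≤Lr+mr)
    where
    Lr≤w : Lr ≤ w N
    Lr≤w = ℤP.≤-trans (C .Lr≤mb) (smaller-half Lb mb (w N) (C .mb≤Lb) (B .x+y≤))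
    w′≤Lr+mr : w (suc N) ≤ Lr + mr
    w′≤Lr+mr = ≤-from-¬ (Lr + mr) (w (suc N)) r∉ λ Lr+mr<w′ → NotBothEven-Oct⇒φ≤ N nbe
      (Octagon-quadrant Lr mr (w N) _ (0≤Lr C) (0≤mr C) Lr≤w (ℤP.≤-trans (C .mr≤Lr) Lr≤w) (+1≤⇒≤-1 Lr+mr<w′))

  new-remainder-φ≤-W-NotBothEven : ∀ N {Lb mb Lr mr} → Config Lb mb Lr mr → Oct (suc N) Lb mb →
    ¬ φ≤ N (Lr + mr i) → NotBothEven (mb - Lr) (Lb - mr) → φ≤ N ((mb - Lr) + (Lb - mr) i)
  new-remainder-φ≤-W-NotBothEven N {Lb} {mb} {Lr} {mr} C B r∉ nbe = NotBothEven-Oct⇒φ≤ N nbe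
    (Octagon-quadrant (mb - Lr) (Lb - mr) (w N) _ (W-re-nonneg C) (W-im-nonneg C)
      (ℤP.≤-trans (W-re≤W-im C) y≤w) y≤w (+1≤⇒≤-1 W-sum<w′))
    where
    P = 2^⌊ N /2⌋
    2P≤Lr+mr : P + P ≤ Lr + mr
    2P≤Lr+mr = ≤-from-¬ (Lr + mr) (P + P) r∉ (diamond⇒φ≤ N Lr mr (0≤Lr C) (0≤mr C) (1≤Lr+mr C))
    W-sum<w′ : (mb - Lr) + (Lb - mr) + + 1 ≤ w (suc N)
    W-sum<w′ = W-sum-bound Lb mb Lr mr (P + P) (w (suc N))
      (subst (λ t → Lb + mb ≤ t - + 1) (trans (w-suc-suc N) (ℤP.+-comm (w (suc N)) (P + P))) (B .x+y≤)) 2P≤Lr+mr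
    y≤w : Lb - mr ≤ w N
    y≤w with mr + + 1 ℤP.≤? 2^⌈ N /2⌉
    ... | no mr≮P′ =
      tall (w N) (2^⌈ N /2⌉) (subst (Lb ≤_) (w-suc N) (B .x≤)) (+1≤+1⇒≤ {2^⌈ N /2⌉} {mr} (≰⇒+1≤ mr≮P′))
      where
      tall : ∀ a P′ → Lb ≤ a + P′ → P′ ≤ mr → Lb - mr ≤ a
      tall a P′ h₁ h₂ = ≤-by-slack _ (slack h₁ ⊕ slack h₂) (solve (Lb ∷ mr ∷ a ∷ P′ ∷ []))
    ... | yes mr<P′ = long (w N) (B .x+y≤)
      (≤-from-¬ (Lr + mr) (w N + + 1 + + 1) r∉ λ lt →
        strip⇒φ≤ N Lr mr (C .1≤mr) (C .mr≤Lr) mr<P′ (+1≤+1⇒≤ {Lr + mr} {w N + + 1} lt))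
      where
      long : ∀ a → Lb + mb ≤ a + a + + 2 - + 1 → a + + 1 + + 1 ≤ Lr + mr → Lb - mr ≤ a
      long a h₁ h₂ = ≤-by-slack _ (slack h₁ ⊕ slack (C .Lr≤mb) ⊕ slack h₂ ⊕ nonneg 1) (solve (Lb ∷ mb ∷ Lr ∷ mr ∷ a ∷ []))

  double-decompose : ∀ m p s → m - (p + p) ≡ s + s → m ≡ (s + p) + (s + p)
  double-decompose m p s eq = begin
    m                      ≡⟨ solve (m ∷ p ∷ []) ⟩
    m - (p + p) + (p + p)  ≡⟨ cong (_+ (p + p)) eq ⟩
    s + s + (p + p)        ≡⟨ solve (s ∷ p ∷ []) ⟩
    (s + p) + (s + p)      ∎

  Config-halve : ∀ {Lb mb p q s t} → Config Lb mb (p + p) (q + q) →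
    Lb ≡ (t + q) + (t + q) → mb ≡ (s + p) + (s + p) → mb - (p + p) ≡ s + s → Config (t + q) (s + p) p q
  Config-halve {Lb} {mb} {p} {q} {s} {t} C Lb≡ mb≡ mb-2p≡ = record
    { 1≤mr = double-pos⁻¹ q (C .1≤mr)
    ; mr≤Lr = double-cancel-≤ q p (C .mr≤Lr)
    ; Lr≤mb = ≤+nonnegˡ p (double-nonneg⁻¹ s (subst (+ 0 ≤_) mb-2p≡ (W-re-nonneg C)))
    ; mb≤Lb = double-cancel-≤ (s + p) (t + q) (subst₂ _≤_ mb≡ Lb≡ (C .mb≤Lb))
    ; off-diagonal = λ t+q≡s+p p≡q →
        C .off-diagonal (trans Lb≡ (trans (cong (λ v → v + v) t+q≡s+p) (sym mb≡))) (cong (λ v → v + v) p≡q)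
    }

  mutual
    new-remainder-φ≤ : ∀ N {Lb mb Lr mr} → Config Lb mb Lr mr → φ≤ (suc N) (Lb + mb i) → ¬ φ≤ N (Lr + mr i) →
      φ≤ N ((mb - Lr) + (Lb - mr) i)
    new-remainder-φ≤ N {Lb} {mb} {Lr} {mr} C b∈ r∉ with parity-cases Lr mr
    ... | inj₂ nbe = new-remainder-φ≤-r-NotBothEven N C (φ≤⇒Oct b∈) r∉ nbe
    ... | inj₁ ((p , refl) , (q , refl)) with parity-cases (mb - (p + p)) (Lb - (q + q))
    ...   | inj₂ nbe = new-remainder-φ≤-W-NotBothEven N C (φ≤⇒Oct b∈) r∉ nbe
    ...   | inj₁ ((s , mb-2p≡) , (t , Lb-2q≡)) = new-remainder-φ≤-all-even N {p = p} {q} {s} {t} C mb-2p≡ Lb-2q≡ b∈ r∉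

    new-remainder-φ≤-all-even : ∀ N {Lb mb p q s t} → Config Lb mb (p + p) (q + q) →
      mb - (p + p) ≡ s + s → Lb - (q + q) ≡ t + t →
      φ≤ (suc N) (Lb + mb i) → ¬ φ≤ N ((p + p) + (q + q) i) → φ≤ N ((mb - (p + p)) + (Lb - (q + q)) i)
    new-remainder-φ≤-all-even N {Lb} {mb} {p} {q} {s} {t} C mb-2p≡ Lb-2q≡ (k , k≤1+N , rep) r∉
      with Rep-halve {k} {t + q} {s + p} (subst (Rep k) (cong₂ _+_i Lb≡ mb≡) rep)
      where
      Lb≡ = double-decompose Lb q t Lb-2q≡
      mb≡ = double-decompose mb p s mb-2p≡
    new-remainder-φ≤-all-even zero C _ _ (_ , s≤s () , _) _ | _ , refl , _
    new-remainder-φ≤-all-even (suc zero) {Lb} {mb} {p} {q} {s} {t} C mb-2p≡ Lb-2q≡ _ _ | zero , refl , rep₀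
      with Rep₀-on-axis rep₀
    ... | inj₁ t+q≡0 = ⊥-elim (1≰0 (subst (+ 1 ≤_) t+q≡0 (double-pos⁻¹ (t + q) (subst (+ 1 ≤_) Lb≡ 1≤Lb))))
      where
      Lb≡ = double-decompose Lb q t Lb-2q≡
      1≤Lb = ℤP.≤-trans (1≤mb C) (C .mb≤Lb)
    ... | inj₂ s+p≡0 = ⊥-elim (1≰0 (subst (+ 1 ≤_) s+p≡0 (double-pos⁻¹ (s + p) (subst (+ 1 ≤_) mb≡ (1≤mb C)))))
      where
      mb≡ = double-decompose mb p s mb-2p≡
    new-remainder-φ≤-all-even (suc zero) C _ _ (_ , s≤s (s≤s ()) , _) _ | suc _ , refl , _
    new-remainder-φ≤-all-even (suc (suc N)) {Lb} {mb} {p} {q} {s} {t} C mb-2p≡ Lb-2q≡ (k , k≤3+N , _) r∉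
      | k′ , refl , rep′ =
      subst (φ≤ (suc (suc N))) (cong₂ _+_i (sym mb-2p≡) (sym Lb-2q≡))
        (φ≤-double (subst (φ≤ N) (cong₂ _+_i (cancel s p) (cancel t q))
          (new-remainder-φ≤ N (Config-halve {p = p} {q} {s} {t} C Lb≡ mb≡ mb-2p≡)
            (k′ , ℕP.≤-pred (ℕP.≤-pred k≤3+N) , rep′)
            (λ r′∈ → r∉ (φ≤-double r′∈)))))
      where
      Lb≡ = double-decompose Lb q t Lb-2q≡
      mb≡ = double-decompose mb p s mb-2p≡
      cancel : ∀ s p → (s + p) - p ≡ s
      cancel = solve-∀

  -- Normalising by units

  ℓ∞-unit : ∀ u z → ℓ∞ (unit u *ᵍ z) ≡ ℓ∞ z
  ℓ∞-unit u1 z = cong ℓ∞ (*ᵍ-identityˡ z)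
  ℓ∞-unit u-1 (x + y i) =
    trans (cong ℓ∞ (-1*ᵍ x y)) (cong₂ ℕ._⊔_ (ℤP.∣-i∣≡∣i∣ x) (ℤP.∣-i∣≡∣i∣ y))
  ℓ∞-unit ui (x + y i) =
    trans (cong ℓ∞ (i*ᵍ x y)) (trans (cong (ℕ._⊔ ∣ x ∣) (ℤP.∣-i∣≡∣i∣ y)) (ℕP.⊔-comm ∣ y ∣ ∣ x ∣))
  ℓ∞-unit u-i (x + y i) =
    trans (cong ℓ∞ (-i*ᵍ x y)) (trans (cong (∣ y ∣ ℕ.⊔_) (ℤP.∣-i∣≡∣i∣ x)) (ℕP.⊔-comm ∣ y ∣ ∣ x ∣))

  mᵍ-unit : ∀ u z → mᵍ (unit u *ᵍ z) ≡ mᵍ z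
  mᵍ-unit u1 z = cong mᵍ (*ᵍ-identityˡ z)
  mᵍ-unit u-1 (x + y i) =
    trans (cong mᵍ (-1*ᵍ x y)) (cong₂ ℕ._⊓_ (ℤP.∣-i∣≡∣i∣ x) (ℤP.∣-i∣≡∣i∣ y))
  mᵍ-unit ui (x + y i) =
    trans (cong mᵍ (i*ᵍ x y)) (trans (cong (ℕ._⊓ ∣ x ∣) (ℤP.∣-i∣≡∣i∣ y)) (ℕP.⊓-comm ∣ y ∣ ∣ x ∣))
  mᵍ-unit u-i (x + y i) =
    trans (cong mᵍ (-i*ᵍ x y)) (trans (cong (∣ y ∣ ℕ.⊓_) (ℤP.∣-i∣≡∣i∣ x)) (ℕP.⊓-comm ∣ y ∣ ∣ x ∣))

  record UnitNormalForm (z : ℤ[i]) (u : Unit) : Set where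
    field
      re≡ℓ∞ : re (unit u *ᵍ z) ≡ + ℓ∞ z
      im≡±m : im (unit u *ᵍ z) ≡ + mᵍ z ⊎ im (unit u *ᵍ z) ≡ - + mᵍ z
      diagonal : ℓ∞ z ≡ mᵍ z → im (unit u *ᵍ z) ≡ + ℓ∞ z

  open UnitNormalForm

  IsUz⇒UnitNormalForm : ∀ z u → IsUz z u → UnitNormalForm z u
  IsUz⇒UnitNormalForm z u (off-diag , on-diag) with ℓ∞ z ℕP.≟ mᵍ z
  ... | yes ℓ≡m = record
    { re≡ℓ∞ = cong re (on-diag ℓ≡m)
    ; im≡±m = inj₁ (trans (cong im (on-diag ℓ≡m)) (cong +_ ℓ≡m))
    ; diagonal = λ ℓ≡m′ → cong im (on-diag ℓ≡m′)
    }
  ... | no ℓ≢m = record { re≡ℓ∞ = off-diag ℓ≢m ; im≡±m = im≡±m′ ; diagonal = λ ℓ≡m → ⊥-elim (ℓ≢m ℓ≡m) }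
    where
    v = unit u *ᵍ z
    ∣re∣≡ℓ∞ : ∣ re v ∣ ≡ ℓ∞ z
    ∣re∣≡ℓ∞ = cong ∣_∣ (off-diag ℓ≢m)
    ∣im∣≤ℓ∞ : ∣ im v ∣ ℕ.≤ ℓ∞ z
    ∣im∣≤ℓ∞ = ℕP.m⊔n≡m⇒n≤m (trans (cong (ℕ._⊔ ∣ im v ∣) (sym ∣re∣≡ℓ∞)) (ℓ∞-unit u z))
    ∣im∣≡m : ∣ im v ∣ ≡ mᵍ z
    ∣im∣≡m = trans (sym (ℕP.m≥n⇒m⊓n≡n ∣im∣≤ℓ∞)) (trans (cong (ℕ._⊓ ∣ im v ∣) (sym ∣re∣≡ℓ∞)) (mᵍ-unit u z))
    im≡±m′ : im v ≡ + mᵍ z ⊎ im v ≡ - + mᵍ z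
    im≡±m′ with ℤP.+∣i∣≡i⊎+∣i∣≡-i (im v)
    ... | inj₁ e = inj₁ (trans (sym e) (cong +_ ∣im∣≡m))
    ... | inj₂ e = inj₂ (trans (sym (ℤP.neg-involutive (im v))) (cong -_ (trans (sym e) (cong +_ ∣im∣≡m))))

  UnitNormalForm-≡ : ∀ {z u} → UnitNormalForm z u → ∀ {y} → im (unit u *ᵍ z) ≡ y → unit u *ᵍ z ≡ (+ ℓ∞ z) + y i
  UnitNormalForm-≡ {z} {u} N refl = cong (_+ im (unit u *ᵍ z) i) (N .re≡ℓ∞)

  neg≢pos : ∀ {m} k → 1 ℕ.≤ m → - + m ≢ + k
  neg≢pos k (s≤s _) ()

  opposite-signs : ∀ {Y Z} m k → Y ≡ + m ⊎ Y ≡ - + m → Z ≡ + k ⊎ Z ≡ - + k → Y * Z < + 0 →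
    (Y ≡ - + m × Z ≡ + k ⊎ Y ≡ + m × Z ≡ - + k) × 1 ℕ.≤ m × 1 ℕ.≤ k
  opposite-signs zero k (inj₁ refl) _ (+<+ ())
  opposite-signs zero k (inj₂ refl) _ (+<+ ())
  opposite-signs {Y} (suc m) zero _ (inj₁ refl) YZ<0 = ⊥-elim (ℤP.<-irrefl refl (subst (_< + 0) (ℤP.*-zeroʳ Y) YZ<0))
  opposite-signs {Y} (suc m) zero _ (inj₂ refl) YZ<0 = ⊥-elim (ℤP.<-irrefl refl (subst (_< + 0) (ℤP.*-zeroʳ Y) YZ<0))
  opposite-signs (suc m) (suc k) (inj₁ refl) (inj₁ refl) (+<+ ())
  opposite-signs (suc m) (suc k) (inj₂ refl) (inj₂ refl) (+<+ ())
  opposite-signs (suc m) (suc k) (inj₁ Y≡) (inj₂ Z≡) _ = inj₂ (Y≡ , Z≡) , s≤s z≤n , s≤s z≤n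
  opposite-signs (suc m) (suc k) (inj₂ Y≡) (inj₁ Z≡) _ = inj₁ (Y≡ , Z≡) , s≤s z≤n , s≤s z≤n

  sgn-pos : ∀ {m} → 1 ℕ.≤ m → sgn (+ m) ≡ + 1
  sgn-pos (s≤s _) = refl

  sgn-neg : ∀ {m} → 1 ℕ.≤ m → sgn (- + m) ≡ - + 1
  sgn-neg (s≤s _) = refl

  Rep₀⇒mᵍ≡0 : ∀ {z} → Rep 0 z → mᵍ z ≡ 0
  Rep₀⇒mᵍ≡0 {z} r with Rep₀-on-axis r
  ... | inj₁ re≡0 = cong (λ t → ∣ t ∣ ℕ.⊓ ∣ im z ∣) re≡0
  ... | inj₂ im≡0 = trans (cong (λ t → ∣ re z ∣ ℕ.⊓ ∣ t ∣) im≡0) (ℕP.⊓-zeroʳ ∣ re z ∣)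

  -- u_r (r − u_b i σ ū_r b) = u_r r − iσ (u_b b), as u_r ū_r = 1.
  *ᵍ-adjusted : ∀ u v p q S →
    unit u *ᵍ (p -ᵍ (v *ᵍ iᵍ *ᵍ S *ᵍ conj (unit u)) *ᵍ q) ≡ unit u *ᵍ p -ᵍ (iᵍ *ᵍ S) *ᵍ (v *ᵍ q)
  *ᵍ-adjusted u v p q S = trans (*ᵍ-distribˡ-minusᵍ U p (X *ᵍ q)) (cong (U *ᵍ p -ᵍ_) (begin
    U *ᵍ (X *ᵍ q)                 ≡⟨ sym (*ᵍ-assoc U X q) ⟩
    (U *ᵍ X) *ᵍ q                 ≡⟨ cong (_*ᵍ q) UX≡ ⟩
    ((v *ᵍ iᵍ) *ᵍ S) *ᵍ q         ≡⟨ cong (_*ᵍ q) (*ᵍ-assoc v iᵍ S) ⟩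
    (v *ᵍ (iᵍ *ᵍ S)) *ᵍ q         ≡⟨ cong (_*ᵍ q) (*ᵍ-comm v (iᵍ *ᵍ S)) ⟩
    ((iᵍ *ᵍ S) *ᵍ v) *ᵍ q         ≡⟨ *ᵍ-assoc (iᵍ *ᵍ S) v q ⟩
    (iᵍ *ᵍ S) *ᵍ (v *ᵍ q)         ∎))
    where
    U = unit u
    X = v *ᵍ iᵍ *ᵍ S *ᵍ conj U
    UX≡ : U *ᵍ X ≡ v *ᵍ iᵍ *ᵍ S
    UX≡ = begin
      U *ᵍ (v *ᵍ iᵍ *ᵍ S *ᵍ conj U)  ≡⟨ cong (U *ᵍ_) (*ᵍ-comm (v *ᵍ iᵍ *ᵍ S) (conj U)) ⟩
      U *ᵍ (conj U *ᵍ (v *ᵍ iᵍ *ᵍ S))  ≡⟨ cong (λ c → U *ᵍ (c *ᵍ (v *ᵍ iᵍ *ᵍ S))) (sym (unit-conjᵘ u)) ⟩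
      U *ᵍ (unit (conjᵘ u) *ᵍ (v *ᵍ iᵍ *ᵍ S))  ≡⟨ *ᵍ-left-comm U (unit (conjᵘ u)) _ ⟩
      unit (conjᵘ u) *ᵍ (U *ᵍ (v *ᵍ iᵍ *ᵍ S))  ≡⟨ conjᵘ-cancel u _ ⟩
      v *ᵍ iᵍ *ᵍ S                             ∎

  W-neg-pos : ∀ Lr mr Lb mb → (Lr + mr i) -ᵍ unit ui *ᵍ (Lb + (- mb) i) ≡ unit u-1 *ᵍ ((mb - Lr) + (Lb - mr) i)
  W-neg-pos Lr mr Lb mb = begin
    (Lr + mr i) -ᵍ unit ui *ᵍ (Lb + (- mb) i)  ≡⟨ cong ((Lr + mr i) -ᵍ_) (i*ᵍ Lb (- mb)) ⟩
    (Lr + mr i) -ᵍ ((- - mb) + Lb i)           ≡⟨ cong₂ _+_i (solve (Lr ∷ mb ∷ [])) (solve (mr ∷ Lb ∷ [])) ⟩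
    (- (mb - Lr)) + (- (Lb - mr)) i            ≡⟨ sym (-1*ᵍ (mb - Lr) (Lb - mr)) ⟩
    unit u-1 *ᵍ ((mb - Lr) + (Lb - mr) i)      ∎

  W-pos-neg : ∀ Lr mr Lb mb → (Lr + (- mr) i) -ᵍ unit u-i *ᵍ (Lb + mb i) ≡ unit u-1 *ᵍ conj ((mb - Lr) + (Lb - mr) i)
  W-pos-neg Lr mr Lb mb = begin
    (Lr + (- mr) i) -ᵍ unit u-i *ᵍ (Lb + mb i)  ≡⟨ cong ((Lr + (- mr) i) -ᵍ_) (-i*ᵍ Lb mb) ⟩
    (Lr + (- mr) i) -ᵍ (mb + (- Lb) i)          ≡⟨ cong₂ _+_i (solve (Lr ∷ mb ∷ [])) (solve (mr ∷ Lb ∷ [])) ⟩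
    (- (mb - Lr)) + (- - (Lb - mr)) i           ≡⟨ sym (-1*ᵍ (mb - Lr) (- (Lb - mr))) ⟩
    unit u-1 *ᵍ conj ((mb - Lr) + (Lb - mr) i)  ∎

  φ≥⇒¬φ≤ : ∀ {N z} → (∀ k → IsPhi z k → suc N ℕ.≤ k) → ¬ φ≤ N z
  φ≥⇒¬φ≤ {N} {z} φ≥ z∈ with φ≤⇒IsPhi N z z∈
  ... | k , k≤N , φ = ℕP.<-irrefl refl (ℕP.<-≤-trans (s≤s k≤N) (φ≥ k φ))

  conclude : ∀ N T ur c W → unit ur *ᵍ T ≡ unit c *ᵍ W → φ≤ N W → ∃[ k ] k ℕ.< suc N × IsPhi T k
  conclude N T ur c W eq W∈ with φ≤⇒IsPhi N T (φ≤-unit⁻¹ ur (subst (φ≤ N) (sym eq) (φ≤-unit c W∈)))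
  ... | k , k≤N , φ = k , s≤s k≤N , φ

  Config-of : ∀ b r → 1 ℕ.≤ mᵍ r → ℓ∞ r ℕ.≤ mᵍ b → (ℓ∞ b ≡ mᵍ b → ℓ∞ r ≢ mᵍ r) →
    Config (+ ℓ∞ b) (+ mᵍ b) (+ ℓ∞ r) (+ mᵍ r)
  Config-of b r 1≤mr Lr≤mb off = record
    { 1≤mr = +≤+ 1≤mr
    ; mr≤Lr = +≤+ (ℕP.m⊓n≤m⊔n ∣ re r ∣ ∣ im r ∣)
    ; Lr≤mb = +≤+ Lr≤mb
    ; mb≤Lb = +≤+ (ℕP.m⊓n≤m⊔n ∣ re b ∣ ∣ im b ∣)
    ; off-diagonal = λ Lb≡mb Lr≡mr → off (ℤP.+-injective Lb≡mb) (ℤP.+-injective Lr≡mr)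
    }

  cong-−* : ∀ {x x′ σ σ′ y y′} → x ≡ x′ → σ ≡ σ′ → y ≡ y′ → x -ᵍ σ *ᵍ y ≡ x′ -ᵍ σ′ *ᵍ y′
  cong-−* refl refl refl = refl

  adjustedRemainder : ℤ[i] → ℤ[i] → Unit → Unit → ℤ[i]
  adjustedRemainder r b ub ur = r -ᵍ (unit ub *ᵍ iᵍ *ᵍ ℤ→ᵍ (s r ur) *ᵍ conj (unit ur)) *ᵍ b

  module _ {r b ub ur} (NB : UnitNormalForm b ub) (NR : UnitNormalForm r ur) {N} (rep-b : Rep (suc N) b)
           (φr≥n : ∀ k → IsPhi r k → suc N ℕ.≤ k) (Lr≤mb : ℓ∞ r ℕ.≤ mᵍ b) (1≤mb : 1 ℕ.≤ mᵍ b) (1≤mr : 1 ℕ.≤ mᵍ r)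
           where

    lemma8-im-b-negative : im (unit ub *ᵍ b) ≡ - + mᵍ b → im (unit ur *ᵍ r) ≡ + mᵍ r →
      ∃[ k ] k ℕ.< suc N × IsPhi (adjustedRemainder r b ub ur) k
    lemma8-im-b-negative Y≡ Z≡ = conclude N _ ur u-1 _
      (begin
        unit ur *ᵍ adjustedRemainder r b ub ur
          ≡⟨ *ᵍ-adjusted ur (unit ub) r b (ℤ→ᵍ (s r ur)) ⟩
        unit ur *ᵍ r -ᵍ (iᵍ *ᵍ ℤ→ᵍ (s r ur)) *ᵍ (unit ub *ᵍ b)
          ≡⟨ cong-−* (UnitNormalForm-≡ NR Z≡) (cong (λ σ → iᵍ *ᵍ ℤ→ᵍ σ) (trans (cong sgn Z≡) (sgn-pos 1≤mr)))
                     (UnitNormalForm-≡ NB Y≡) ⟩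
        ((+ ℓ∞ r) + (+ mᵍ r) i) -ᵍ unit ui *ᵍ ((+ ℓ∞ b) + (- + mᵍ b) i)
          ≡⟨ W-neg-pos (+ ℓ∞ r) (+ mᵍ r) (+ ℓ∞ b) (+ mᵍ b) ⟩
        unit u-1 *ᵍ ((+ mᵍ b - + ℓ∞ r) + (+ ℓ∞ b - + mᵍ r) i)
          ∎)
      (new-remainder-φ≤ N (Config-of b r 1≤mr Lr≤mb off-diagonal′) b∈ r∉)
      where
      off-diagonal′ : ℓ∞ b ≡ mᵍ b → ℓ∞ r ≢ mᵍ r
      off-diagonal′ Lb≡mb _ = neg≢pos (ℓ∞ b) 1≤mb (trans (sym Y≡) (NB .diagonal Lb≡mb))
      b∈ : φ≤ (suc N) ((+ ℓ∞ b) + (+ mᵍ b) i)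
      b∈ = suc N , ℕP.≤-refl , subst (Rep (suc N))
        (trans (cong conj (UnitNormalForm-≡ NB Y≡)) (cong ((+ ℓ∞ b) +_i) (ℤP.neg-involutive (+ mᵍ b))))
        (Rep-conj (Rep-unit ub rep-b))
      r∉ : ¬ φ≤ N ((+ ℓ∞ r) + (+ mᵍ r) i)
      r∉ r∈ = φ≥⇒¬φ≤ φr≥n (φ≤-unit⁻¹ ur (subst (φ≤ N) (sym (UnitNormalForm-≡ NR Z≡)) r∈))

    lemma8-im-b-positive : im (unit ub *ᵍ b) ≡ + mᵍ b → im (unit ur *ᵍ r) ≡ - + mᵍ r →
      ∃[ k ] k ℕ.< suc N × IsPhi (adjustedRemainder r b ub ur) k
    lemma8-im-b-positive Y≡ Z≡ = conclude N _ ur u-1 _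
      (begin
        unit ur *ᵍ adjustedRemainder r b ub ur
          ≡⟨ *ᵍ-adjusted ur (unit ub) r b (ℤ→ᵍ (s r ur)) ⟩
        unit ur *ᵍ r -ᵍ (iᵍ *ᵍ ℤ→ᵍ (s r ur)) *ᵍ (unit ub *ᵍ b)
          ≡⟨ cong-−* (UnitNormalForm-≡ NR Z≡) (cong (λ σ → iᵍ *ᵍ ℤ→ᵍ σ) (trans (cong sgn Z≡) (sgn-neg 1≤mr)))
                     (UnitNormalForm-≡ NB Y≡) ⟩
        ((+ ℓ∞ r) + (- + mᵍ r) i) -ᵍ unit u-i *ᵍ ((+ ℓ∞ b) + (+ mᵍ b) i)
          ≡⟨ W-pos-neg (+ ℓ∞ r) (+ mᵍ r) (+ ℓ∞ b) (+ mᵍ b) ⟩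
        unit u-1 *ᵍ conj ((+ mᵍ b - + ℓ∞ r) + (+ ℓ∞ b - + mᵍ r) i)
          ∎)
      (φ≤-conj (new-remainder-φ≤ N (Config-of b r 1≤mr Lr≤mb off-diagonal′) b∈ r∉))
      where
      off-diagonal′ : ℓ∞ b ≡ mᵍ b → ℓ∞ r ≢ mᵍ r
      off-diagonal′ _ Lr≡mr = neg≢pos (ℓ∞ r) 1≤mr (trans (sym Z≡) (NR .diagonal Lr≡mr))
      b∈ : φ≤ (suc N) ((+ ℓ∞ b) + (+ mᵍ b) i)
      b∈ = suc N , ℕP.≤-refl , subst (Rep (suc N)) (UnitNormalForm-≡ NB Y≡) (Rep-unit ub rep-b)
      r∉ : ¬ φ≤ N ((+ ℓ∞ r) + (+ mᵍ r) i)
      r∉ r∈ = φ≥⇒¬φ≤ φr≥n (φ≤-unit⁻¹ ur (subst (φ≤ N) (sym (UnitNormalForm-≡ NR Z≡)) (φ≤-conj r∈)))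

  lemma8-from-normal-forms : ∀ r b ub ur → UnitNormalForm b ub → UnitNormalForm r ur →
    im (unit ub *ᵍ b) * im (unit ur *ᵍ r) < + 0 →
    ∀ n → Rep n b → (∀ k → IsPhi r k → n ℕ.≤ k) → ℓ∞ r ℕ.≤ mᵍ b →
    ∃[ k ] k ℕ.< n × IsPhi (adjustedRemainder r b ub ur) k
  lemma8-from-normal-forms r b ub ur NB NR YZ<0 n rep-b φr≥n Lr≤mb
    with opposite-signs (mᵍ b) (mᵍ r) (NB .im≡±m) (NR .im≡±m) YZ<0 | n
  ... | _ , 1≤mb , _ | zero = ⊥-elim (ℕP.<-irrefl (sym (Rep₀⇒mᵍ≡0 rep-b)) 1≤mb)
  ... | inj₁ (Y≡ , Z≡) , 1≤mb , 1≤mr | suc N = lemma8-im-b-negative NB NR rep-b φr≥n Lr≤mb 1≤mb 1≤mr Y≡ Z≡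
  ... | inj₂ (Y≡ , Z≡) , 1≤mb , 1≤mr | suc N = lemma8-im-b-positive NB NR rep-b φr≥n Lr≤mb 1≤mb 1≤mr Y≡ Z≡

open import Data.Nat using (ℕ; _≤_; _<_)
open import Data.Integer as ℤ using (+_)
open import Data.Product using (∃-syntax; _×_; _,_)
open import Relation.Binary.PropositionalEquality using (_≢_)

lemma8 : (a b : ℤ[i]) → a ≢ 0ᵍ → b ≢ 0ᵍ → gaussRem a b ≢ 0ᵍ →
  (ub ur : Unit) → IsUz b ub → IsUz (gaussRem a b) ur →
  (im (unit ub *ᵍ b)) ℤ.* (im (unit ur *ᵍ gaussRem a b)) ℤ.< + 0 →
  (n : ℕ) → IsPhi b n → (∀ k → IsPhi (gaussRem a b) k → n ≤ k) →
  ℓ∞ (gaussRem a b) ≤ mᵍ b →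
  ∃[ k ] (k < n × IsPhi
    (gaussRem a b -ᵍ
      (unit ub *ᵍ iᵍ *ᵍ ℤ→ᵍ (s (gaussRem a b) ur) *ᵍ conj (unit ur)) *ᵍ b) k)
lemma8 a b _ _ _ ub ur Ub Ur YZ<0 n (rep-b , _) =
  lemma8-from-normal-forms (gaussRem a b) b ub ur (IsUz⇒UnitNormalForm b ub Ub) (IsUz⇒UnitNormalForm _ ur Ur) YZ<0 n rep-b
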